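{- The monoid $R_n^0$ has exactly $2^n$ idempotents: they are the elements $\pi_S$, $S\subseteq\{0,1,\dots,n-1\}$, where $\pi_S$ is the zero element of the submonoid of $R_n^0$ generated by $\{\pi_i: i\in S\}$.
   Context: $R_n^0$ is the monoid presented by generators $\pi_0,\dots,\pi_{n-1}$ and relations $\pi_i^2=\pi_i$ ($0\le i\le n-1$), $\pi_i\pi_{i+1}\pi_i=\pi_{i+1}\pi_i\pi_{i+1}$ ($1\le i\le n-2$), $\pi_1\pi_0\pi_1\pi_0=\pi_0\pi_1\pi_0=\pi_0\pi_1\pi_0\pi_1$, $\pi_i\pi_j=\pi_j\pi_i$ ($0\le i,j\le n-1$, $|i-j|\ge2$). It is finite and $\mathcal{J}$-trivial, so each submonoid generated by a set of generators has a unique zero element (an element $z$ with $zx=xz=z$ for all $x$ in the submonoid). -}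

module Defs where

open import Data.Nat using (ℕ; zero; suc; _+_; _≤_)
open import Data.Fin using (Fin; toℕ)
open import Data.Fin.Subset using (Subset; _∈_)
open import Data.List using (List; []; _∷_; _++_)
open import Data.List.Relation.Unary.All using (All)
open import Data.Product using (_×_)
open import Relation.Binary.PropositionalEquality using (_≡_)

-- Words in the generators π_0 … π_{n-1}; the letter i : Fin n stands for π_i.
Word : ℕ → Set
Word n = List (Fin n)

data _⟶_ {n : ℕ} : Word n → Word n → Set where
  idem  : (a : Fin n) → (a ∷ a ∷ []) ⟶ (a ∷ [])
  braid : (a b : Fin n) → 1 ≤ toℕ a → toℕ b ≡ suc (toℕ a) →
          (a ∷ b ∷ a ∷ []) ⟶ (b ∷ a ∷ b ∷ [])
  left  : (a b : Fin n) → toℕ a ≡ 0 → toℕ b ≡ 1 →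
          (b ∷ a ∷ b ∷ a ∷ []) ⟶ (a ∷ b ∷ a ∷ [])
  right : (a b : Fin n) → toℕ a ≡ 0 → toℕ b ≡ 1 →
          (a ∷ b ∷ a ∷ b ∷ []) ⟶ (a ∷ b ∷ a ∷ [])
  -- π_i π_j = π_j π_i   (|i - j| ≥ 2; the other orientation comes from symmetry)
  comm  : (a b : Fin n) → toℕ a + 2 ≤ toℕ b →
          (a ∷ b ∷ []) ⟶ (b ∷ a ∷ [])

-- The congruence on words generated by the relations: u ∼ v iff u and v
-- represent the same element of R_n^0 (the monoid is Word n / ∼, with
-- concatenation as product and [] as identity).
infix 4 _∼_
data _∼_ {n : ℕ} : Word n → Word n → Set where
  ∼-refl  : {u : Word n} → u ∼ u
  ∼-sym   : {u v : Word n} → u ∼ v → v ∼ u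
  ∼-trans : {u v w : Word n} → u ∼ v → v ∼ w → u ∼ w
  ∼-step  : (x y : Word n) {l r : Word n} → l ⟶ r → (x ++ l ++ y) ∼ (x ++ r ++ y)

IsIdempotent : {n : ℕ} → Word n → Set
IsIdempotent e = (e ++ e) ∼ e

-- Membership in the submonoid generated by {π_i : i ∈ S}:
-- the element is represented by a word using only letters from S.
InSubmonoid : {n : ℕ} → Subset n → Word n → Set
InSubmonoid S w = All (_∈ S) w

IsZeroOf : {n : ℕ} → Subset n → Word n → Set
IsZeroOf S z = InSubmonoid S z ×
  ((x : Word _) → InSubmonoid S x → ((z ++ x) ∼ z) × ((x ++ z) ∼ z))

-- R_n^0 acts faithfully on partial injections of n cells: π_0 empties the first
-- cell and π_i sorts cells i − 1, i into decreasing order.  Faithfulness comes from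
-- a normal form, built cell by cell, with exactly one canonical word per partial
-- injection.  Every letter either fixes a configuration or strictly lowers the
-- potential Σ (p + 1)·s(p), so a high power of a word listing S reaches a
-- configuration fixed by every π_i, i ∈ S: the power absorbs these letters on the
-- right, and by the reversal symmetry of the presentation also on the left, so it is
-- the zero π_S.  An idempotent e fixes its own configuration, hence is absorbing for
-- its own letters S, and e = e π_S = π_S.  The set of letters of a word is invariant
-- under the relations, which makes S ↦ π_S injective.
module Submission where

open import Defs
import Algebra.Solver.Monoid as MS
open import Data.Empty using (⊥-elim)
open import Data.Fin using (Fin; toℕ; fromℕ<)
import Data.Fin.Properties as FP
open import Data.Fin.Properties using (toℕ-fromℕ<; fromℕ<-toℕ; toℕ<n)
open import Data.Fin.Subset using (Subset; ⁅_⁆; _∪_) renaming (_∈_ to _∈S_; _⊆_ to _⊆S_; ⊥ to ∅)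
open import Data.Fin.Subset.Properties using (x∈⁅x⁆; x∈⁅y⁆⇒x≡y; x∈p∪q⁺; x∈p∪q⁻; ∉⊥; ⊆-antisym; _∈?_)
open import Data.List using (List; []; _∷_; _++_; [_]; map; reverse; filter; foldr; allFin)
open import Data.List.Properties using (++-assoc; ++-identityʳ; map-++; reverse-++; reverse-involutive; ++-monoid)
open import Data.List.Membership.Propositional using (_∈_)
open import Data.List.Membership.Propositional.Properties using (∈-map⁺; ∈-++⁻; ∈-filter⁺; ∈-filter⁻; ∈-allFin)
open import Data.List.Relation.Binary.Subset.Propositional using (_⊆_)
open import Data.List.Relation.Binary.Subset.Propositional.Properties using (⊆-refl; ⊆-trans; ++⁺ʳ; ++⁺ˡ; xs⊆xs++ys)
open import Data.List.Relation.Unary.Any using (here; there)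
import Data.List.Relation.Unary.Any.Properties as AnyP
open import Data.List.Relation.Unary.All using (All; []; _∷_)
import Data.List.Relation.Unary.All as All
open import Data.List.Relation.Unary.All.Properties using (++⁺)
open import Data.Nat using (ℕ; zero; suc; _+_; _∸_; _≤_; _<_; z≤n; s≤s; _<?_; _≤?_; pred; _⊔_; _⊓_; _≟_)
open import Data.Nat.Properties
open import Data.Product using (Σ; ∃; _×_; _,_; proj₁; proj₂; swap)
open import Data.Sum using (_⊎_; inj₁; inj₂)
open import Function using (_∘_)
open import Level using (0ℓ)
open import Relation.Binary.Bundles using (Setoid)
open import Relation.Binary.Definitions using (tri<; tri≈; tri>)
open import Relation.Binary.PropositionalEquality hiding ([_])
import Relation.Binary.Reasoning.Setoid as SetoidReasoning
open import Relation.Nullary using (Dec; yes; no; ¬_)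

-- Words with letters in ℕ present the union of all the R_m^0; the normal form is
-- built by induction on m, so it lives here and is transferred to R_n^0.
ℕWord : Set
ℕWord = List ℕ

data Rule : ℕWord → ℕWord → Set where
  r-idem  : ∀ a → Rule (a ∷ a ∷ []) (a ∷ [])
  r-braid : ∀ a b → 1 ≤ a → b ≡ suc a → Rule (a ∷ b ∷ a ∷ []) (b ∷ a ∷ b ∷ [])
  r-left  : ∀ a b → a ≡ 0 → b ≡ 1 → Rule (b ∷ a ∷ b ∷ a ∷ []) (a ∷ b ∷ a ∷ [])
  r-right : ∀ a b → a ≡ 0 → b ≡ 1 → Rule (a ∷ b ∷ a ∷ b ∷ []) (a ∷ b ∷ a ∷ [])
  r-comm  : ∀ a b → a + 2 ≤ b → Rule (a ∷ b ∷ []) (b ∷ a ∷ [])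

infix 4 _≈_
data _≈_ : ℕWord → ℕWord → Set where
  ≈-refl  : ∀ {u} → u ≈ u
  ≈-sym   : ∀ {u v} → u ≈ v → v ≈ u
  ≈-trans : ∀ {u v w} → u ≈ v → v ≈ w → u ≈ w
  ≈-step  : ∀ x y {l r} → Rule l r → (x ++ l ++ y) ≈ (x ++ r ++ y)

++-regroup : ∀ {A : Set} (x x′ l y′ y : List A) →
             x ++ (x′ ++ l ++ y′) ++ y ≡ (x ++ x′) ++ l ++ (y′ ++ y)
++-regroup x x′ l y′ y = begin
  x ++ (x′ ++ l ++ y′) ++ y   ≡⟨ cong (x ++_) (++-assoc x′ (l ++ y′) y) ⟩
  x ++ x′ ++ (l ++ y′) ++ y   ≡⟨ cong (λ z → x ++ x′ ++ z) (++-assoc l y′ y) ⟩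
  x ++ x′ ++ l ++ y′ ++ y     ≡⟨ sym (++-assoc x x′ _) ⟩
  (x ++ x′) ++ l ++ (y′ ++ y) ∎
  where open ≡-Reasoning

≈-cong : ∀ x y {u v} → u ≈ v → (x ++ u ++ y) ≈ (x ++ v ++ y)
≈-cong x y ≈-refl        = ≈-refl
≈-cong x y (≈-sym p)     = ≈-sym (≈-cong x y p)
≈-cong x y (≈-trans p q) = ≈-trans (≈-cong x y p) (≈-cong x y q)
≈-cong x y (≈-step x′ y′ {l} {r} R) =
  subst₂ _≈_ (sym (++-regroup x x′ l y′ y)) (sym (++-regroup x x′ r y′ y))
             (≈-step (x ++ x′) (y′ ++ y) R)

≈-congˡ : ∀ x {u v} → u ≈ v → (x ++ u) ≈ (x ++ v)
≈-congˡ x {u} {v} p =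
  subst₂ _≈_ (cong (x ++_) (++-identityʳ u)) (cong (x ++_) (++-identityʳ v)) (≈-cong x [] p)

≈-congʳ : ∀ y {u v} → u ≈ v → (u ++ y) ≈ (v ++ y)
≈-congʳ y p = ≈-cong [] y p

≈-setoid : Setoid 0ℓ 0ℓ
≈-setoid = record
  { Carrier = ℕWord ; _≈_ = _≈_
  ; isEquivalence = record { refl = ≈-refl ; sym = ≈-sym ; trans = ≈-trans } }

open SetoidReasoning ≈-setoid

≡⇒≈ : ∀ {u v} → u ≡ v → u ≈ v
≡⇒≈ refl = ≈-refl

Rule⇒≈ : ∀ {l r} → Rule l r → l ≈ r
Rule⇒≈ {l} {r} R = subst₂ _≈_ (++-identityʳ l) (++-identityʳ r) (≈-step [] [] R)

∼-cong : ∀ {n} (x y : Word n) {u v} → u ∼ v → (x ++ u ++ y) ∼ (x ++ v ++ y)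
∼-cong x y ∼-refl        = ∼-refl
∼-cong x y (∼-sym p)     = ∼-sym (∼-cong x y p)
∼-cong x y (∼-trans p q) = ∼-trans (∼-cong x y p) (∼-cong x y q)
∼-cong x y (∼-step x′ y′ {l} {r} R) =
  subst₂ _∼_ (sym (++-regroup x x′ l y′ y)) (sym (++-regroup x x′ r y′ y))
             (∼-step (x ++ x′) (y′ ++ y) R)

⟶⇒∼ : ∀ {n} {l r : Word n} → l ⟶ r → l ∼ r
⟶⇒∼ {l = l} {r} R = subst₂ _∼_ (++-identityʳ l) (++-identityʳ r) (∼-step [] [] R)

∼-congˡ : ∀ {n} (x : Word n) {u v} → u ∼ v → (x ++ u) ∼ (x ++ v)
∼-congˡ x {u} {v} p =
  subst₂ _∼_ (cong (x ++_) (++-identityʳ u)) (cong (x ++_) (++-identityʳ v)) (∼-cong x [] p)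

∼-congʳ : ∀ {n} (y : Word n) {u v} → u ∼ v → (u ++ y) ∼ (v ++ y)
∼-congʳ y p = ∼-cong [] y p

≡⇒∼ : ∀ {n} {u v : Word n} → u ≡ v → u ∼ v
≡⇒∼ refl = ∼-refl

⟪_⟫ : ∀ {n} → Word n → ℕWord
⟪ w ⟫ = map toℕ w

⟶⇒Rule : ∀ {n} {l r : Word n} → l ⟶ r → Rule ⟪ l ⟫ ⟪ r ⟫
⟶⇒Rule (idem a)         = r-idem _
⟶⇒Rule (braid a b h e)  = r-braid _ _ h e
⟶⇒Rule (left a b ea eb)  = r-left _ _ ea eb
⟶⇒Rule (right a b ea eb) = r-right _ _ ea eb
⟶⇒Rule (comm a b h)     = r-comm _ _ h

⟪⟫-++ : ∀ {n} (x l y : Word n) → ⟪ x ++ l ++ y ⟫ ≡ ⟪ x ⟫ ++ ⟪ l ⟫ ++ ⟪ y ⟫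
⟪⟫-++ x l y = trans (map-++ toℕ x (l ++ y)) (cong (⟪ x ⟫ ++_) (map-++ toℕ l y))

∼⇒≈ : ∀ {n} {u v : Word n} → u ∼ v → ⟪ u ⟫ ≈ ⟪ v ⟫
∼⇒≈ ∼-refl        = ≈-refl
∼⇒≈ (∼-sym p)     = ≈-sym (∼⇒≈ p)
∼⇒≈ (∼-trans p q) = ≈-trans (∼⇒≈ p) (∼⇒≈ q)
∼⇒≈ (∼-step x y {l} {r} R) =
  subst₂ _≈_ (sym (⟪⟫-++ x l y)) (sym (⟪⟫-++ x r y)) (≈-step ⟪ x ⟫ ⟪ y ⟫ (⟶⇒Rule R))

module Restrict (n : ℕ) where

  restrictLetter : ∀ {i} → Dec (i < n) → Word n
  restrictLetter (yes i<n) = fromℕ< i<n ∷ []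
  restrictLetter (no _)    = []

  restrict : ℕWord → Word n
  restrict []      = []
  restrict (i ∷ w) = restrictLetter (i <? n) ++ restrict w

  restrict-++ : ∀ u v → restrict (u ++ v) ≡ restrict u ++ restrict v
  restrict-++ [] v = refl
  restrict-++ (i ∷ u) v =
    trans (cong (restrictLetter (i <? n) ++_) (restrict-++ u v))
          (sym (++-assoc (restrictLetter (i <? n)) (restrict u) (restrict v)))

  restrict-++₃ : ∀ x l y → restrict (x ++ l ++ y) ≡ restrict x ++ restrict l ++ restrict y
  restrict-++₃ x l y = trans (restrict-++ x (l ++ y)) (cong (restrict x ++_) (restrict-++ l y))

  restrict-Rule : ∀ {l r} → Rule l r → restrict l ∼ restrict r
  restrict-Rule (r-idem a) with a <? n
  ... | yes _ = ⟶⇒∼ (idem _)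
  ... | no _  = ∼-refl
  restrict-Rule (r-braid a b h refl) with a <? n | b <? n
  ... | yes p | yes q = ⟶⇒∼ (braid _ _ (subst (1 ≤_) (sym (toℕ-fromℕ< p)) h)
                                       (trans (toℕ-fromℕ< q) (cong suc (sym (toℕ-fromℕ< p)))))
  ... | yes _ | no _  = ⟶⇒∼ (idem _)
  ... | no a≮n | yes b<n = ⊥-elim (a≮n (<-trans (n<1+n a) b<n))
  ... | no _ | no _   = ∼-refl
  restrict-Rule (r-left a b refl refl) with a <? n | b <? n
  ... | yes p | yes q = ⟶⇒∼ (left _ _ (toℕ-fromℕ< p) (toℕ-fromℕ< q))
  ... | yes _ | no _  = ∼-refl
  ... | no a≮n | yes b<n = ⊥-elim (a≮n (<-trans (n<1+n 0) b<n))
  ... | no _ | no _   = ∼-refl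
  restrict-Rule (r-right a b refl refl) with a <? n | b <? n
  ... | yes p | yes q = ⟶⇒∼ (right _ _ (toℕ-fromℕ< p) (toℕ-fromℕ< q))
  ... | yes _ | no _  = ∼-refl
  ... | no a≮n | yes b<n = ⊥-elim (a≮n (<-trans (n<1+n 0) b<n))
  ... | no _ | no _   = ∼-refl
  restrict-Rule (r-comm a b h) with a <? n | b <? n
  ... | yes p | yes q = ⟶⇒∼ (comm _ _ (subst₂ (λ x y → x + 2 ≤ y) (sym (toℕ-fromℕ< p)) (sym (toℕ-fromℕ< q)) h))
  ... | yes _ | no _  = ∼-refl
  ... | no _  | yes _ = ∼-refl
  ... | no _  | no _  = ∼-refl

  restrict-≈ : ∀ {u v} → u ≈ v → restrict u ∼ restrict v
  restrict-≈ ≈-refl        = ∼-refl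
  restrict-≈ (≈-sym p)     = ∼-sym (restrict-≈ p)
  restrict-≈ (≈-trans p q) = ∼-trans (restrict-≈ p) (restrict-≈ q)
  restrict-≈ (≈-step x y {l} {r} R) =
    subst₂ _∼_ (sym (restrict-++₃ x l y)) (sym (restrict-++₃ x r y))
               (∼-cong (restrict x) (restrict y) (restrict-Rule R))

  restrict-⟪⟫ : ∀ (w : Word n) → restrict ⟪ w ⟫ ≡ w
  restrict-⟪⟫ [] = refl
  restrict-⟪⟫ (i ∷ w) with toℕ i <? n
  ... | yes p  = cong₂ _∷_ (fromℕ<-toℕ i p) (restrict-⟪⟫ w)
  ... | no i≮n = ⊥-elim (i≮n (toℕ<n i))

  ≈⇒∼ : ∀ {u v : Word n} → ⟪ u ⟫ ≈ ⟪ v ⟫ → u ∼ v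
  ≈⇒∼ {u} {v} p = subst₂ _∼_ (restrict-⟪⟫ u) (restrict-⟪⟫ v) (restrict-≈ p)

-- R_n^0 acts on the right on configurations: position p holds s p, where 0 means
-- "empty" and a positive value is a token.  π_0 empties position 0 and π_(k+1)
-- sorts positions k, k+1 into decreasing order.  Starting from `initial`, the
-- reachable configurations are exactly the partial injections (`Rook` below).
Config : Set
Config = ℕ → ℕ

clear₀ : Config → Config
clear₀ s zero    = 0
clear₀ s (suc p) = s (suc p)

set₂ : ℕ → ℕ → ℕ → Config → Config
set₂ zero    a b s zero          = a
set₂ zero    a b s (suc zero)    = b
set₂ zero    a b s (suc (suc p)) = s (suc (suc p))
set₂ (suc k) a b s zero          = s zero
set₂ (suc k) a b s (suc p)       = set₂ k a b (λ q → s (suc q)) p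

act : Config → ℕ → Config
act s zero    = clear₀ s
act s (suc k) = set₂ k (s k ⊔ s (suc k)) (s k ⊓ s (suc k)) s

run : Config → ℕWord → Config
run s []      = s
run s (x ∷ w) = run (act s x) w

cons : ℕ → Config → Config
cons a t zero    = a
cons a t (suc p) = t p

run-++ : ∀ s u v → run s (u ++ v) ≡ run (run s u) v
run-++ s []      v = refl
run-++ s (x ∷ u) v = run-++ (act s x) u v

run-++-at : ∀ s u v p → run s (u ++ v) p ≡ run (run s u) v p
run-++-at s u v p = cong (λ t → t p) (run-++ s u v)

set₂-at : ∀ k a b s → set₂ k a b s k ≡ a
set₂-at zero    a b s = refl
set₂-at (suc k) a b s = set₂-at k a b _

set₂-at-suc : ∀ k a b s → set₂ k a b s (suc k) ≡ b
set₂-at-suc zero    a b s = refl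
set₂-at-suc (suc k) a b s = set₂-at-suc k a b _

set₂-other : ∀ k a b s p → p ≢ k → p ≢ suc k → set₂ k a b s p ≡ s p
set₂-other zero    a b s zero          p≢k _ = ⊥-elim (p≢k refl)
set₂-other zero    a b s (suc zero)    _ p≢k+1 = ⊥-elim (p≢k+1 refl)
set₂-other zero    a b s (suc (suc p)) _ _ = refl
set₂-other (suc k) a b s zero          _ _ = refl
set₂-other (suc k) a b s (suc p) p≢k p≢k+1 =
  set₂-other k a b _ p (p≢k ∘ cong suc) (p≢k+1 ∘ cong suc)

set₂-below : ∀ k a b s p → p < k → set₂ k a b s p ≡ s p
set₂-below k a b s p p<k =
  set₂-other k a b s p (λ e → <-irrefl e p<k) (λ e → <-irrefl refl (<-trans (n<1+n k) (subst (_< k) e p<k)))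

set₂-above : ∀ k a b s p → suc k < p → set₂ k a b s p ≡ s p
set₂-above k a b s p k+1<p =
  set₂-other k a b s p (λ e → <-irrefl (sym e) (<-trans (n<1+n k) k+1<p)) (λ e → <-irrefl (sym e) k+1<p)

set₂-cases : ∀ k a b (s : Config) p →
             (p ≡ k × set₂ k a b s p ≡ a) ⊎ (p ≡ suc k × set₂ k a b s p ≡ b)
             ⊎ (p ≢ k × p ≢ suc k × set₂ k a b s p ≡ s p)
set₂-cases k a b s p with p ≟ k | p ≟ suc k
... | yes refl | _        = inj₁ (refl , set₂-at k a b s)
... | no _     | yes refl = inj₂ (inj₁ (refl , set₂-at-suc k a b s))
... | no p≢k   | no p≢k+1 = inj₂ (inj₂ (p≢k , p≢k+1 , set₂-other k a b s p p≢k p≢k+1))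

set₂-cong : ∀ k {a a′ b b′} {s t : Config} → a ≡ a′ → b ≡ b′ → s ≗ t → set₂ k a b s ≗ set₂ k a′ b′ t
set₂-cong zero    refl refl s≗t zero          = refl
set₂-cong zero    refl refl s≗t (suc zero)    = refl
set₂-cong zero    refl refl s≗t (suc (suc p)) = s≗t _
set₂-cong (suc k) refl refl s≗t zero          = s≗t zero
set₂-cong (suc k) refl refl s≗t (suc p)       = set₂-cong k refl refl (s≗t ∘ suc) p

set₂-set₂ : ∀ k a b c d s → set₂ k a b (set₂ k c d s) ≗ set₂ k a b s
set₂-set₂ zero    a b c d s zero          = refl
set₂-set₂ zero    a b c d s (suc zero)    = refl
set₂-set₂ zero    a b c d s (suc (suc p)) = refl
set₂-set₂ (suc k) a b c d s zero          = refl
set₂-set₂ (suc k) a b c d s (suc p)       = set₂-set₂ k a b c d _ p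

set₂-self : ∀ k s → set₂ k (s k) (s (suc k)) s ≗ s
set₂-self zero    s zero          = refl
set₂-self zero    s (suc zero)    = refl
set₂-self zero    s (suc (suc p)) = refl
set₂-self (suc k) s zero          = refl
set₂-self (suc k) s (suc p)       = set₂-self k _ p

act-cong : ∀ {s t} x → s ≗ t → act s x ≗ act t x
act-cong zero    s≗t zero    = refl
act-cong zero    s≗t (suc p) = s≗t (suc p)
act-cong (suc k) s≗t =
  set₂-cong k (cong₂ _⊔_ (s≗t k) (s≗t (suc k))) (cong₂ _⊓_ (s≗t k) (s≗t (suc k))) s≗t

run-cong : ∀ {s t} w → s ≗ t → run s w ≗ run t w
run-cong []      s≗t = s≗t
run-cong (x ∷ w) s≗t = run-cong w (act-cong x s≗t)

act-shift : ∀ s k → act s (suc (suc k)) ≗ cons (s 0) (act (s ∘ suc) (suc k))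
act-shift s k zero    = refl
act-shift s k (suc p) = refl

run-shift : ∀ s w → run s (map (suc ∘ suc) w) ≗ cons (s 0) (run (s ∘ suc) (map suc w))
run-shift s []      zero    = refl
run-shift s []      (suc p) = refl
run-shift s (k ∷ w) p = trans (run-cong (map (suc ∘ suc) w) (act-shift s k) p)
                              (run-shift (cons (s 0) (act (s ∘ suc) (suc k))) w p)

cons-cong : ∀ a {s t} → s ≗ t → cons a s ≗ cons a t
cons-cong a s≗t zero    = refl
cons-cong a s≗t (suc p) = s≗t p

sort-braid-top : ∀ x y z → (x ⊔ y) ⊔ ((x ⊓ y) ⊔ z) ≡ x ⊔ (y ⊔ z)
sort-braid-top zero    y       z       = refl
sort-braid-top (suc x) zero    z       = refl
sort-braid-top (suc x) (suc y) zero    = cong suc (m≥n⇒m⊔n≡m (m⊓n≤m⊔n x y))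
sort-braid-top (suc x) (suc y) (suc z) = cong suc (sort-braid-top x y z)

sort-braid-middle : ∀ x y z → (x ⊔ y) ⊓ ((x ⊓ y) ⊔ z) ≡ (x ⊓ (y ⊔ z)) ⊔ (y ⊓ z)
sort-braid-middle zero    y       z       = refl
sort-braid-middle (suc x) zero    z       = sym (⊔-identityʳ _)
sort-braid-middle (suc x) (suc y) zero    = cong suc (m≥n⇒m⊓n≡n (m⊓n≤m⊔n x y))
sort-braid-middle (suc x) (suc y) (suc z) = cong suc (sort-braid-middle x y z)

sort-braid-bottom : ∀ x y z → (x ⊓ y) ⊓ z ≡ (x ⊓ (y ⊔ z)) ⊓ (y ⊓ z)
sort-braid-bottom zero    y       z       = refl
sort-braid-bottom (suc x) zero    z       = sym (⊓-zeroʳ _)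
sort-braid-bottom (suc x) (suc y) zero    = refl
sort-braid-bottom (suc x) (suc y) (suc z) = cong suc (sort-braid-bottom x y z)

run-braid : ∀ i s → run s (suc i ∷ suc (suc i) ∷ suc i ∷ []) ≗ run s (suc (suc i) ∷ suc i ∷ suc (suc i) ∷ [])
run-braid zero s zero                = sort-braid-top (s 0) (s 1) (s 2)
run-braid zero s (suc zero)          = sort-braid-middle (s 0) (s 1) (s 2)
run-braid zero s (suc (suc zero))    = sort-braid-bottom (s 0) (s 1) (s 2)
run-braid zero s (suc (suc (suc p))) = refl
run-braid (suc i) s p = trans (run-shift s (i ∷ suc i ∷ i ∷ []) p)
                       (trans (cons-cong (s 0) (run-braid i (s ∘ suc)) p)
                              (sym (run-shift s (suc i ∷ i ∷ suc i ∷ []) p)))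

run-comm : ∀ a b → a + 2 ≤ b → ∀ s → run s (a ∷ b ∷ []) ≗ run s (b ∷ a ∷ [])
run-comm zero          (suc zero)          (s≤s ()) s
run-comm (suc zero)    (suc zero)          (s≤s ()) s
run-comm (suc zero)    (suc (suc zero))    (s≤s (s≤s ())) s
run-comm zero          (suc (suc k))       _ s zero          = refl
run-comm zero          (suc (suc k))       _ s (suc p)       = refl
run-comm (suc zero)    (suc (suc (suc k))) _ s zero          = refl
run-comm (suc zero)    (suc (suc (suc k))) _ s (suc zero)    = refl
run-comm (suc zero)    (suc (suc (suc k))) _ s (suc (suc p)) = refl
run-comm (suc (suc i)) (suc (suc j)) (s≤s (s≤s h)) s p =
  trans (run-shift s (i ∷ j ∷ []) p)
  (trans (cons-cong (s 0) (run-comm (suc i) (suc j) (s≤s h) (s ∘ suc)) p)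
         (sym (run-shift s (j ∷ i ∷ []) p)))

run-idem : ∀ a s → run s (a ∷ a ∷ []) ≗ run s (a ∷ [])
run-idem zero    s zero    = refl
run-idem zero    s (suc p) = refl
run-idem (suc k) s p =
  trans (set₂-cong k max-again min-again (λ _ → refl) p) (set₂-set₂ k M m M m s p)
  where
  M = s k ⊔ s (suc k)
  m = s k ⊓ s (suc k)
  t = set₂ k M m s
  max-again : t k ⊔ t (suc k) ≡ M
  max-again = trans (cong₂ _⊔_ (set₂-at k M m s) (set₂-at-suc k M m s)) (m≥n⇒m⊔n≡m (m⊓n≤m⊔n (s k) (s (suc k))))
  min-again : t k ⊓ t (suc k) ≡ m
  min-again = trans (cong₂ _⊓_ (set₂-at k M m s) (set₂-at-suc k M m s)) (m≥n⇒m⊓n≡n (m⊓n≤m⊔n (s k) (s (suc k))))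

Rule⇒run≗ : ∀ {l r} → Rule l r → ∀ s → run s l ≗ run s r
Rule⇒run≗ (r-idem a)                  s = run-idem a s
Rule⇒run≗ (r-braid (suc i) b h refl)  s = run-braid i s
Rule⇒run≗ (r-left .0 .1 refl refl)    s zero          = refl
Rule⇒run≗ (r-left .0 .1 refl refl)    s (suc zero)    = refl
Rule⇒run≗ (r-left .0 .1 refl refl)    s (suc (suc p)) = refl
Rule⇒run≗ (r-right .0 .1 refl refl)   s zero          = refl
Rule⇒run≗ (r-right .0 .1 refl refl)   s (suc zero)    = refl
Rule⇒run≗ (r-right .0 .1 refl refl)   s (suc (suc p)) = refl
Rule⇒run≗ (r-comm a b h)              s = run-comm a b h s

run-++₃ : ∀ s x l y p → run s (x ++ l ++ y) p ≡ run (run (run s x) l) y p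
run-++₃ s x l y p = trans (run-++-at s x (l ++ y) p) (run-++-at (run s x) l y p)

≈⇒run≗ : ∀ {u v} → u ≈ v → ∀ s → run s u ≗ run s v
≈⇒run≗ ≈-refl          s p = refl
≈⇒run≗ (≈-sym u≈v)     s p = sym (≈⇒run≗ u≈v s p)
≈⇒run≗ (≈-trans u≈v v≈w) s p = trans (≈⇒run≗ u≈v s p) (≈⇒run≗ v≈w s p)
≈⇒run≗ (≈-step x y {l} {r} R) s p =
  trans (run-++₃ s x l y p)
  (trans (run-cong y (Rule⇒run≗ R (run s x)) p)
  (sym (run-++₃ s x r y p)))

-- On configurations, down k d moves the token at k + d
-- down to position k when it exceeds the tokens at k, …, k + d − 1, and sink j
-- empties position 0 and moves the empty cell up to position j.
down : ℕ → ℕ → ℕWord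
down k zero = []
down k (suc d) = suc (k + d) ∷ down k d

up : ℕ → ℕWord
up zero = []
up (suc j) = up j ++ [ suc j ]

sink : ℕ → ℕWord
sink j = 0 ∷ up j

downSink : ℕ → ℕ → ℕWord
downSink m j = down 0 m ++ sink j

Far : ℕ → ℕ → Set
Far x y = suc (suc x) ≤ y ⊎ suc (suc y) ≤ x

Far⇒swap : ∀ {x y} → Far x y → (y ∷ x ∷ []) ≈ (x ∷ y ∷ [])
Far⇒swap {x} {y} (inj₁ h) = ≈-sym (Rule⇒≈ (r-comm x y (subst (_≤ y) (+-comm 2 x) h)))
Far⇒swap {x} {y} (inj₂ h) = Rule⇒≈ (r-comm y x (subst (_≤ x) (+-comm 2 y) h))

pass-letter : ∀ x w → All (Far x) w → (w ++ [ x ]) ≈ (x ∷ w)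
pass-letter x [] [] = ≈-refl
pass-letter x (y ∷ w) (f ∷ fs) = ≈-trans (≈-congˡ [ y ] (pass-letter x w fs)) (≈-congʳ w (Far⇒swap f))

pass-word : ∀ w1 w2 → All (λ x → All (Far x) w1) w2 → (w1 ++ w2) ≈ (w2 ++ w1)
pass-word w1 []        []       = ≡⇒≈ (++-identityʳ w1)
pass-word w1 (x ∷ w2) (f ∷ fs) = begin
  w1 ++ x ∷ w2         ≡⟨ sym (++-assoc w1 [ x ] w2) ⟩
  (w1 ++ [ x ]) ++ w2  ≈⟨ ≈-congʳ w2 (pass-letter x w1 f) ⟩
  x ∷ w1 ++ w2         ≈⟨ ≈-congˡ [ x ] (pass-word w1 w2 fs) ⟩
  x ∷ w2 ++ w1         ∎

far-above : ∀ {x a} w → x ≤ a → All (λ y → suc (suc a) ≤ y) w → All (Far x) w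
far-above w h = All.map (λ h' → inj₁ (≤-trans (s≤s (s≤s h)) h'))

far-below : ∀ {x a} w → suc (suc a) ≤ x → All (λ y → y ≤ a) w → All (Far x) w
far-below w h = All.map (λ h' → inj₂ (≤-trans (s≤s (s≤s h')) h))

down-lower : ∀ k d → All (λ y → suc k ≤ y) (down k d)
down-lower k zero = []
down-lower k (suc d) = s≤s (m≤m+n k d) ∷ down-lower k d

down-upper : ∀ k d → All (λ y → y ≤ k + d) (down k d)
down-upper k zero = []
down-upper k (suc d) =
  ≤-reflexive (sym (+-suc k d)) ∷ All.map (λ y≤ → ≤-trans y≤ (+-monoʳ-≤ k (n≤1+n d))) (down-upper k d)

up-upper : ∀ j → All (λ y → y ≤ j) (up j)
up-upper zero = []
up-upper (suc j) = ++⁺ (All.map (λ h → ≤-trans h (n≤1+n j)) (up-upper j)) (≤-refl ∷ [])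

sink-upper : ∀ j → All (λ y → y ≤ j) (sink j)
sink-upper j = z≤n ∷ up-upper j

down-snoc : ∀ k d → down (suc k) d ++ [ suc k ] ≡ down k (suc d)
down-snoc k zero = cong (λ z → suc z ∷ []) (sym (+-identityʳ k))
down-snoc k (suc d) = cong₂ _∷_ (cong suc (sym (+-suc k d))) (down-snoc k d)

down-split : ∀ k e d → down k (e + d) ≡ down (k + d) e ++ down k d
down-split k zero d = refl
down-split k (suc e) d = cong₂ _∷_ (cong suc (trans (cong (k +_) (+-comm e d)) (sym (+-assoc k d e)))) (down-split k e d)

down-absorb : ∀ k d → (down k (suc d) ++ [ suc k ]) ≈ down k (suc d)
down-absorb k d = begin
  down k (suc d) ++ [ suc k ]                  ≡⟨ cong (_++ [ suc k ]) (sym (down-snoc k d)) ⟩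
  (down (suc k) d ++ [ suc k ]) ++ [ suc k ]  ≡⟨ ++-assoc (down (suc k) d) [ suc k ] [ suc k ] ⟩
  down (suc k) d ++ suc k ∷ suc k ∷ []        ≈⟨ ≈-congˡ (down (suc k) d) (Rule⇒≈ (r-idem (suc k))) ⟩
  down (suc k) d ++ [ suc k ]                  ≡⟨ down-snoc k d ⟩
  down k (suc d)                               ∎

down-shift : ∀ k d y → suc k ≤ y → y < k + d → (down k d ++ [ suc y ]) ≈ (y ∷ down k d)
down-shift k zero y h1 h2 = ⊥-elim (<-asym h1 (subst (y <_) (+-identityʳ k) h2))
down-shift k (suc e) y h1 h2 with <-cmp y (k + e)
... | tri< lt _ _ = ≈-trans (≈-congˡ [ suc (k + e) ] (down-shift k e y h1 lt)) (≈-congʳ (down k e) (Far⇒swap (inj₁ (s≤s lt))))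
... | tri> _ _ gt = ⊥-elim (<-irrefl refl (<-≤-trans gt (≤-pred (subst (y <_) (+-suc k e) h2))))
down-shift k (suc zero) y h1 h2 | tri≈ _ eq _ = ⊥-elim (<-irrefl (sym (trans eq (+-identityʳ k))) h1)
down-shift k (suc (suc e')) y h1 h2 | tri≈ _ eq _ = braided (trans eq (+-suc k e'))
  where
  braided : y ≡ suc (k + e') → (suc (k + suc e') ∷ suc (k + e') ∷ down k e' ++ [ suc y ]) ≈ (y ∷ suc (k + suc e') ∷ suc (k + e') ∷ down k e')
  braided refl rewrite +-suc k e' =
    ≈-trans (≈-congˡ (suc (suc (k + e')) ∷ suc (k + e') ∷ []) (pass-letter (suc (suc (k + e'))) (down k e') (far-below (down k e') ≤-refl (down-upper k e'))))
           (≈-congʳ (down k e') (≈-sym (Rule⇒≈ (r-braid (suc (k + e')) (suc (suc (k + e'))) (s≤s z≤n) refl))))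

open MS (++-monoid ℕ) using (solve; _⊜_; _⊕_) renaming (id to ε)

up-shift : ∀ j x → 1 ≤ x → x < j → (up j ++ [ x ]) ≈ (suc x ∷ up j)
up-shift (suc j) x 1≤x x<j+1 with <-cmp x j
... | tri< x<j _ _ = begin
  (up j ++ [ suc j ]) ++ [ x ]  ≡⟨ ++-assoc (up j) [ suc j ] [ x ] ⟩
  up j ++ suc j ∷ x ∷ []        ≈⟨ ≈-congˡ (up j) (Far⇒swap (inj₁ (s≤s x<j))) ⟩
  up j ++ x ∷ suc j ∷ []        ≡⟨ sym (++-assoc (up j) [ x ] [ suc j ]) ⟩
  (up j ++ [ x ]) ++ [ suc j ]  ≈⟨ ≈-congʳ [ suc j ] (up-shift j x 1≤x x<j) ⟩
  suc x ∷ up j ++ [ suc j ]     ∎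
... | tri> _ _ x>j = ⊥-elim (<-irrefl refl (<-≤-trans x>j (≤-pred x<j+1)))
up-shift (suc zero) x 1≤x _ | tri≈ _ refl _ = ⊥-elim (<-irrefl refl 1≤x)
up-shift (suc (suc j)) x _ _ | tri≈ _ refl _ = begin
  ((up j ++ a) ++ b) ++ a  ≡⟨ solve 3 (λ c a b → ((c ⊕ a) ⊕ b) ⊕ a ⊜ c ⊕ (a ⊕ b ⊕ a)) refl (up j) a b ⟩
  up j ++ (a ++ b ++ a)    ≈⟨ ≈-congˡ (up j) (Rule⇒≈ (r-braid (suc j) (suc (suc j)) (s≤s z≤n) refl)) ⟩
  up j ++ (b ++ a ++ b)    ≡⟨ solve 3 (λ c a b → c ⊕ (b ⊕ a ⊕ b) ⊜ (c ⊕ b) ⊕ (a ⊕ b)) refl (up j) a b ⟩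
  (up j ++ b) ++ (a ++ b)  ≈⟨ ≈-congʳ (a ++ b) (pass-letter (suc (suc j)) (up j) (far-below (up j) (s≤s (s≤s ≤-refl)) (up-upper j))) ⟩
  b ++ up j ++ a ++ b      ≡⟨ solve 3 (λ c a b → b ⊕ c ⊕ a ⊕ b ⊜ b ⊕ ((c ⊕ a) ⊕ b)) refl (up j) a b ⟩
  b ++ (up j ++ a) ++ b    ∎
  where
  a = [ suc j ]
  b = [ suc (suc j) ]

-- The relations π_1π_0π_1π_0 = π_0π_1π_0 = π_0π_1π_0π_1, propagated along longer
-- words by braiding.

down-sink-π₀ : ∀ i → (down 0 (suc i) ++ sink (suc i) ++ [ 0 ]) ≈ (sink i ++ down 0 (suc i) ++ [ 0 ])
down-sink-π₀ zero = Rule⇒≈ (r-left 0 1 refl refl)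
down-sink-π₀ (suc i) =
  begin (suc j ∷ P) ++ (ZJ ++ [ suc j ]) ++ [ 0 ]
    ≡⟨ solve 5 (λ a p z b c → (a ⊕ p) ⊕ (z ⊕ a) ⊕ c ⊜ (a ⊕ p ⊕ z) ⊕ (a ⊕ c) ⊕ ε) refl [ suc j ] P ZJ [ suc j ] [ 0 ] ⟩
  (suc j ∷ P ++ ZJ) ++ (suc j ∷ 0 ∷ []) ++ []
    ≈⟨ ≈-cong (suc j ∷ P ++ ZJ) [] (Far⇒swap {0} {suc j} (inj₁ (s≤s (s≤s z≤n)))) ⟩
  (suc j ∷ P ++ ZJ) ++ (0 ∷ suc j ∷ []) ++ []
    ≡⟨ solve 5 (λ a p z c b → (a ⊕ p ⊕ z) ⊕ (c ⊕ b) ⊕ ε ⊜ a ⊕ (p ⊕ z ⊕ c) ⊕ b) refl [ suc j ] P ZJ [ 0 ] [ suc j ] ⟩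
  [ suc j ] ++ (P ++ ZJ ++ [ 0 ]) ++ [ suc j ]
    ≈⟨ ≈-cong [ suc j ] [ suc j ] (down-sink-π₀ i) ⟩
  [ suc j ] ++ (sink i ++ P ++ [ 0 ]) ++ [ suc j ]
    ≡⟨ solve 4 (λ a z p c → a ⊕ (z ⊕ p ⊕ c) ⊕ a ⊜ ε ⊕ (a ⊕ z) ⊕ (p ⊕ c ⊕ a)) refl [ suc j ] (sink i) P [ 0 ] ⟩
  [] ++ (suc j ∷ sink i) ++ (P ++ [ 0 ] ++ [ suc j ])
    ≈⟨ ≈-cong [] (P ++ [ 0 ] ++ [ suc j ]) (≈-sym (pass-letter (suc j) (sink i) (far-below (sink i) ≤-refl (sink-upper i)))) ⟩
  [] ++ (sink i ++ [ suc j ]) ++ (P ++ [ 0 ] ++ [ suc j ])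
    ≡⟨ solve 5 (λ z a b q c → ε ⊕ (z ⊕ a) ⊕ ((b ⊕ q) ⊕ c ⊕ a) ⊜ (z ⊕ a ⊕ b) ⊕ ((q ⊕ c) ⊕ a) ⊕ ε) refl (sink i) [ suc j ] [ j ] (down 0 i) [ 0 ] ⟩
  (sink i ++ suc j ∷ j ∷ []) ++ (Q ++ [ suc j ]) ++ []
    ≈⟨ ≈-cong (sink i ++ suc j ∷ j ∷ []) [] (pass-letter (suc j) Q (far-below Q ≤-refl (++⁺ (down-upper 0 i) (z≤n ∷ [])))) ⟩
  (sink i ++ suc j ∷ j ∷ []) ++ (suc j ∷ Q) ++ []
    ≡⟨ solve 5 (λ z a b q c → (z ⊕ a ⊕ b) ⊕ (a ⊕ q ⊕ c) ⊕ ε ⊜ z ⊕ (a ⊕ b ⊕ a) ⊕ (q ⊕ c)) refl (sink i) [ suc j ] [ j ] (down 0 i) [ 0 ] ⟩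
  sink i ++ (suc j ∷ j ∷ suc j ∷ []) ++ Q
    ≈⟨ ≈-cong (sink i) Q (≈-sym (Rule⇒≈ (r-braid j (suc j) (s≤s z≤n) refl))) ⟩
  sink i ++ (j ∷ suc j ∷ j ∷ []) ++ Q
    ≡⟨ solve 5 (λ z b a q c → z ⊕ (b ⊕ a ⊕ b) ⊕ (q ⊕ c) ⊜ (z ⊕ b) ⊕ (a ⊕ b ⊕ q) ⊕ c) refl (sink i) [ j ] [ suc j ] (down 0 i) [ 0 ] ⟩
  (sink i ++ [ j ]) ++ (suc j ∷ j ∷ down 0 i) ++ [ 0 ]
    ∎
  where
  j = suc i
  P = down 0 j
  ZJ = sink j
  Q = down 0 i ++ [ 0 ]

sink-down-sink-absorb : ∀ i → (sink i ++ down 0 (suc i) ++ sink i ++ [ suc i ]) ≈ (sink i ++ down 0 (suc i) ++ sink i)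
sink-down-sink-absorb zero = Rule⇒≈ (r-right 0 1 refl refl)
sink-down-sink-absorb (suc i) = ≈-trans lhs (≈-sym rhs)
  where
  j = suc i
  p = down 0 i
  zi = sink i
  V = p ++ zi
  fV : All (Far (suc j)) V
  fV = far-below V ≤-refl (++⁺ (All.map (λ h → h) (down-upper 0 i)) (sink-upper i))
  fZ : All (Far (suc j)) zi
  fZ = far-below zi ≤-refl (sink-upper i)
  br : (j ∷ suc j ∷ j ∷ []) ≈ (suc j ∷ j ∷ suc j ∷ [])
  br = Rule⇒≈ (r-braid j (suc j) (s≤s z≤n) refl)
  X = [ suc j ] ++ (zi ++ (j ∷ p) ++ zi) ++ (suc j ∷ j ∷ [])
  lhs : ((zi ++ [ j ]) ++ (suc j ∷ j ∷ p) ++ (zi ++ [ j ]) ++ [ suc j ]) ≈ X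
  lhs =
    begin (zi ++ [ j ]) ++ (suc j ∷ j ∷ p) ++ (zi ++ [ j ]) ++ [ suc j ]
      ≡⟨ solve 5 (λ z a b p' c → (z ⊕ a) ⊕ (b ⊕ a ⊕ p') ⊕ (c ⊕ a) ⊕ b ⊜ z ⊕ (a ⊕ b ⊕ a) ⊕ ((p' ⊕ c) ⊕ a ⊕ b)) refl zi [ j ] [ suc j ] p zi ⟩
    zi ++ (j ∷ suc j ∷ j ∷ []) ++ (V ++ j ∷ suc j ∷ [])
      ≈⟨ ≈-cong zi (V ++ j ∷ suc j ∷ []) br ⟩
    zi ++ (suc j ∷ j ∷ suc j ∷ []) ++ (V ++ j ∷ suc j ∷ [])
      ≡⟨ solve 5 (λ z a b p' c → z ⊕ (b ⊕ a ⊕ b) ⊕ ((p' ⊕ c) ⊕ a ⊕ b) ⊜ (z ⊕ b ⊕ a) ⊕ (b ⊕ (p' ⊕ c)) ⊕ (a ⊕ b)) refl zi [ j ] [ suc j ] p zi ⟩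
    (zi ++ suc j ∷ j ∷ []) ++ (suc j ∷ V) ++ (j ∷ suc j ∷ [])
      ≈⟨ ≈-cong (zi ++ suc j ∷ j ∷ []) (j ∷ suc j ∷ []) (≈-sym (pass-letter (suc j) V fV)) ⟩
    (zi ++ suc j ∷ j ∷ []) ++ (V ++ [ suc j ]) ++ (j ∷ suc j ∷ [])
      ≡⟨ solve 5 (λ z a b p' c → (z ⊕ b ⊕ a) ⊕ ((p' ⊕ c) ⊕ b) ⊕ (a ⊕ b) ⊜ (z ⊕ b ⊕ a ⊕ (p' ⊕ c)) ⊕ (b ⊕ a ⊕ b) ⊕ ε) refl zi [ j ] [ suc j ] p zi ⟩
    (zi ++ suc j ∷ j ∷ V) ++ (suc j ∷ j ∷ suc j ∷ []) ++ []
      ≈⟨ ≈-cong (zi ++ suc j ∷ j ∷ V) [] (≈-sym br) ⟩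
    (zi ++ suc j ∷ j ∷ V) ++ (j ∷ suc j ∷ j ∷ []) ++ []
      ≡⟨ solve 5 (λ z a b p' c → (z ⊕ b ⊕ a ⊕ (p' ⊕ c)) ⊕ (a ⊕ b ⊕ a) ⊕ ε ⊜ ε ⊕ (z ⊕ b) ⊕ (a ⊕ (p' ⊕ c) ⊕ a ⊕ b ⊕ a)) refl zi [ j ] [ suc j ] p zi ⟩
    [] ++ (zi ++ [ suc j ]) ++ (j ∷ V ++ j ∷ suc j ∷ j ∷ [])
      ≈⟨ ≈-cong [] (j ∷ V ++ j ∷ suc j ∷ j ∷ []) (pass-letter (suc j) zi fZ) ⟩
    [] ++ (suc j ∷ zi) ++ (j ∷ V ++ j ∷ suc j ∷ j ∷ [])
      ≡⟨ solve 5 (λ z a b p' c → ε ⊕ (b ⊕ z) ⊕ (a ⊕ (p' ⊕ c) ⊕ a ⊕ b ⊕ a) ⊜ b ⊕ (z ⊕ (a ⊕ p') ⊕ c ⊕ a) ⊕ (b ⊕ a)) refl zi [ j ] [ suc j ] p zi ⟩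
    [ suc j ] ++ (zi ++ (j ∷ p) ++ zi ++ [ j ]) ++ (suc j ∷ j ∷ [])
      ≈⟨ ≈-cong [ suc j ] (suc j ∷ j ∷ []) (sink-down-sink-absorb i) ⟩
    X ∎
  rhs : ((zi ++ [ j ]) ++ (suc j ∷ j ∷ p) ++ (zi ++ [ j ])) ≈ X
  rhs =
    begin (zi ++ [ j ]) ++ (suc j ∷ j ∷ p) ++ (zi ++ [ j ])
      ≡⟨ solve 5 (λ z a b p' c → (z ⊕ a) ⊕ (b ⊕ a ⊕ p') ⊕ (c ⊕ a) ⊜ z ⊕ (a ⊕ b ⊕ a) ⊕ ((p' ⊕ c) ⊕ a)) refl zi [ j ] [ suc j ] p zi ⟩
    zi ++ (j ∷ suc j ∷ j ∷ []) ++ (V ++ [ j ])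
      ≈⟨ ≈-cong zi (V ++ [ j ]) br ⟩
    zi ++ (suc j ∷ j ∷ suc j ∷ []) ++ (V ++ [ j ])
      ≡⟨ solve 5 (λ z a b p' c → z ⊕ (b ⊕ a ⊕ b) ⊕ ((p' ⊕ c) ⊕ a) ⊜ (z ⊕ b ⊕ a) ⊕ (b ⊕ (p' ⊕ c)) ⊕ a) refl zi [ j ] [ suc j ] p zi ⟩
    (zi ++ suc j ∷ j ∷ []) ++ (suc j ∷ V) ++ [ j ]
      ≈⟨ ≈-cong (zi ++ suc j ∷ j ∷ []) [ j ] (≈-sym (pass-letter (suc j) V fV)) ⟩
    (zi ++ suc j ∷ j ∷ []) ++ (V ++ [ suc j ]) ++ [ j ]
      ≡⟨ solve 5 (λ z a b p' c → (z ⊕ b ⊕ a) ⊕ ((p' ⊕ c) ⊕ b) ⊕ a ⊜ ε ⊕ (z ⊕ b) ⊕ (a ⊕ (p' ⊕ c) ⊕ b ⊕ a)) refl zi [ j ] [ suc j ] p zi ⟩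
    [] ++ (zi ++ [ suc j ]) ++ (j ∷ V ++ suc j ∷ j ∷ [])
      ≈⟨ ≈-cong [] (j ∷ V ++ suc j ∷ j ∷ []) (pass-letter (suc j) zi fZ) ⟩
    [] ++ (suc j ∷ zi) ++ (j ∷ V ++ suc j ∷ j ∷ [])
      ≡⟨ solve 5 (λ z a b p' c → ε ⊕ (b ⊕ z) ⊕ (a ⊕ (p' ⊕ c) ⊕ b ⊕ a) ⊜ b ⊕ (z ⊕ (a ⊕ p') ⊕ c) ⊕ (b ⊕ a)) refl zi [ j ] [ suc j ] p zi ⟩
    X ∎

down-pass : ∀ k d x → suc x ≤ k → (down k d ++ [ x ]) ≈ (x ∷ down k d)
down-pass k d x lt = pass-letter x (down k d) (All.map (λ h → inj₁ (≤-trans (s≤s lt) h)) (down-lower k d))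

sink-absorb : ∀ j → (sink j ++ [ j ]) ≈ sink j
sink-absorb zero = Rule⇒≈ (r-idem 0)
sink-absorb (suc j) = ≈-congˡ [ 0 ] (begin
  (up j ++ [ suc j ]) ++ [ suc j ]  ≡⟨ ++-assoc (up j) [ suc j ] [ suc j ] ⟩
  up j ++ suc j ∷ suc j ∷ []         ≈⟨ ≈-congˡ (up j) (Rule⇒≈ (r-idem (suc j))) ⟩
  up j ++ [ suc j ]                  ∎)

downSink-absorb : ∀ m j → (downSink m j ++ [ j ]) ≈ downSink m j
downSink-absorb m j = ≈-trans (≡⇒≈ (++-assoc (down 0 m) (sink j) [ j ])) (≈-congˡ (down 0 m) (sink-absorb j))

downSink-snoc : ∀ m j → downSink m j ++ [ suc j ] ≡ downSink m (suc j)
downSink-snoc m j = ++-assoc (down 0 m) (sink j) [ suc j ]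

downSink-shift-above : ∀ m j x → suc (suc j) ≤ x → x ≤ m → (downSink m j ++ [ x ]) ≈ (pred x ∷ downSink m j)
downSink-shift-above m j zero () h2
downSink-shift-above m j (suc zero) (s≤s ()) h2
downSink-shift-above m j (suc (suc y)) h1 h2 =
  begin downSink m j ++ [ suc (suc y) ]
    ≡⟨ ++-assoc (down 0 m) (sink j) _ ⟩
  down 0 m ++ (sink j ++ [ suc (suc y) ])
    ≈⟨ ≈-congˡ (down 0 m) (pass-letter _ (sink j) (far-below (sink j) h1 (sink-upper j))) ⟩
  down 0 m ++ (suc (suc y) ∷ sink j)
    ≡⟨ sym (++-assoc (down 0 m) [ suc (suc y) ] (sink j)) ⟩
  (down 0 m ++ [ suc (suc y) ]) ++ sink j
    ≈⟨ ≈-congʳ (sink j) (down-shift 0 m (suc y) (s≤s z≤n) h2) ⟩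
  suc y ∷ downSink m j ∎

downSink-shift-below : ∀ m j x → 1 ≤ x → x < j → j ≤ m → (downSink m j ++ [ x ]) ≈ (x ∷ downSink m j)
downSink-shift-below m j (suc y) h1 h2 h3 =
  begin downSink m j ++ [ suc y ]
    ≡⟨ ++-assoc (down 0 m) (sink j) _ ⟩
  down 0 m ++ (0 ∷ (up j ++ [ suc y ]))
    ≈⟨ ≈-congˡ (down 0 m) (≈-congˡ [ 0 ] (up-shift j (suc y) h1 h2)) ⟩
  down 0 m ++ ([ 0 ] ++ [ suc (suc y) ]) ++ up j
    ≈⟨ ≈-cong (down 0 m) (up j) (Far⇒swap {suc (suc y)} {0} (inj₂ (s≤s (s≤s z≤n)))) ⟩
  down 0 m ++ ([ suc (suc y) ] ++ [ 0 ]) ++ up j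
    ≡⟨ sym (++-assoc (down 0 m) [ suc (suc y) ] (sink j)) ⟩
  (down 0 m ++ [ suc (suc y) ]) ++ sink j
    ≈⟨ ≈-congʳ (sink j) (down-shift 0 m (suc y) h1 (<-≤-trans h2 h3)) ⟩
  suc y ∷ downSink m j ∎

downSink-π₀ : ∀ m i → suc i ≤ m → (downSink m (suc i) ++ [ 0 ]) ≈ (sink i ++ downSink m 0)
downSink-π₀ m i i<m =
  subst (λ m → (downSink m (suc i) ++ [ 0 ]) ≈ (sink i ++ downSink m 0)) (m∸n+n≡m i<m) (split (m ∸ suc i))
  where
  split : ∀ e → (downSink (e + suc i) (suc i) ++ [ 0 ]) ≈ (sink i ++ downSink (e + suc i) 0)
  split e rewrite down-split 0 e (suc i) =
    begin ((D ++ P) ++ sink (suc i)) ++ [ 0 ]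
      ≡⟨ solve 4 (λ d p z o → ((d ⊕ p) ⊕ z) ⊕ o ⊜ d ⊕ (p ⊕ z ⊕ o)) refl D P (sink (suc i)) [ 0 ] ⟩
    D ++ (P ++ sink (suc i) ++ [ 0 ])
      ≈⟨ ≈-congˡ D (down-sink-π₀ i) ⟩
    D ++ (sink i ++ P ++ [ 0 ])
      ≡⟨ solve 4 (λ d p z o → d ⊕ (z ⊕ p ⊕ o) ⊜ (d ⊕ z) ⊕ (p ⊕ o)) refl D P (sink i) [ 0 ] ⟩
    (D ++ sink i) ++ (P ++ [ 0 ])
      ≈⟨ ≈-congʳ (P ++ [ 0 ]) (pass-word D (sink i) (All.map (λ h → far-above D h (down-lower (suc i) e)) (sink-upper i))) ⟩
    (sink i ++ D) ++ (P ++ [ 0 ])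
      ≡⟨ solve 4 (λ d p z o → (z ⊕ d) ⊕ (p ⊕ o) ⊜ z ⊕ ((d ⊕ p) ⊕ o)) refl D P (sink i) [ 0 ] ⟩
    sink i ++ ((D ++ P) ++ [ 0 ]) ∎
    where
    D = down (suc i) e
    P = down 0 (suc i)

sink-downSink-absorb : ∀ m j → suc j ≤ m → (sink j ++ downSink m j ++ [ suc j ]) ≈ (sink j ++ downSink m j)
sink-downSink-absorb m j j<m =
  subst (λ m → (sink j ++ downSink m j ++ [ suc j ]) ≈ (sink j ++ downSink m j)) (m∸n+n≡m j<m) (split (m ∸ suc j))
  where
  split : ∀ e → (sink j ++ downSink (e + suc j) j ++ [ suc j ]) ≈ (sink j ++ downSink (e + suc j) j)
  split e rewrite down-split 0 e (suc j) =
    begin sink j ++ ((D ++ P) ++ sink j) ++ [ suc j ]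
      ≡⟨ solve 4 (λ d p z o → z ⊕ ((d ⊕ p) ⊕ z) ⊕ o ⊜ (z ⊕ d) ⊕ (p ⊕ z ⊕ o)) refl D P (sink j) [ suc j ] ⟩
    (sink j ++ D) ++ (P ++ sink j ++ [ suc j ])
      ≈⟨ ≈-congʳ (P ++ sink j ++ [ suc j ]) fw ⟩
    (D ++ sink j) ++ (P ++ sink j ++ [ suc j ])
      ≡⟨ solve 4 (λ d p z o → (d ⊕ z) ⊕ (p ⊕ z ⊕ o) ⊜ d ⊕ (z ⊕ p ⊕ z ⊕ o)) refl D P (sink j) [ suc j ] ⟩
    D ++ (sink j ++ P ++ sink j ++ [ suc j ])
      ≈⟨ ≈-congˡ D (sink-down-sink-absorb j) ⟩
    D ++ (sink j ++ P ++ sink j)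
      ≡⟨ solve 3 (λ d p z → d ⊕ (z ⊕ p ⊕ z) ⊜ (d ⊕ z) ⊕ (p ⊕ z)) refl D P (sink j) ⟩
    (D ++ sink j) ++ (P ++ sink j)
      ≈⟨ ≈-congʳ (P ++ sink j) (≈-sym fw) ⟩
    (sink j ++ D) ++ (P ++ sink j)
      ≡⟨ solve 3 (λ d p z → (z ⊕ d) ⊕ (p ⊕ z) ⊜ z ⊕ ((d ⊕ p) ⊕ z)) refl D P (sink j) ⟩
    sink j ++ ((D ++ P) ++ sink j) ∎
    where
    D = down (suc j) e
    P = down 0 (suc j)
    fw : (sink j ++ D) ≈ (D ++ sink j)
    fw = pass-word (sink j) D (All.map (λ h → far-below (sink j) h (sink-upper j)) (down-lower (suc j) e))

initial : Config
initial p = suc p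

Agree : ℕ → Config → Config → Set
Agree L s t = ∀ p → p < L → s p ≡ t p

Occupied : ℕ → Config → Set
Occupied j s = ∀ p → p < j → 0 < s p

record Rook≤ (L B : ℕ) (s : Config) : Set where
  constructor rook
  field
    bounded   : ∀ p → p < L → s p ≤ B
    injective : ∀ p q → p < L → q < L → 0 < s p → s p ≡ s q → p ≡ q

Rook : ℕ → Config → Set
Rook L s = Rook≤ L L s

insert : ℕ → ℕ → Config → Config
insert zero a s zero = a
insert zero a s (suc p) = s p
insert (suc k) a s zero = s zero
insert (suc k) a s (suc p) = insert k a (λ q → s (suc q)) p

insert-below : ∀ k a s p → p < k → insert k a s p ≡ s p
insert-below (suc k) a s zero h = refl
insert-below (suc k) a s (suc p) (s≤s h) = insert-below k a _ p h

insert-at : ∀ k a s → insert k a s k ≡ a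
insert-at zero a s = refl
insert-at (suc k) a s = insert-at k a _

insert-above : ∀ k a s p → k ≤ p → insert k a s (suc p) ≡ s p
insert-above zero a s p h = refl
insert-above (suc k) a s (suc p) (s≤s h) = insert-above k a _ p h

delete : ℕ → Config → Config
delete zero s p = s (suc p)
delete (suc k) s zero = s zero
delete (suc k) s (suc p) = delete k (λ q → s (suc q)) p

delete-below : ∀ k s p → p < k → delete k s p ≡ s p
delete-below (suc k) s zero h = refl
delete-below (suc k) s (suc p) (s≤s h) = delete-below k _ p h

delete-above : ∀ k s p → k ≤ p → delete k s p ≡ s (suc p)
delete-above zero s p h = refl
delete-above (suc k) s (suc p) (s≤s h) = delete-above k _ p h

act-beyond : ∀ s x p → x < p → act s x p ≡ s p
act-beyond s zero (suc p) h = refl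
act-beyond s (suc k) p h = set₂-above k _ _ s p h

run-beyond : ∀ s w L → All (_< L) w → ∀ p → L ≤ p → run s w p ≡ s p
run-beyond s [] L a p h = refl
run-beyond s (x ∷ w) L (hx ∷ a) p h = trans (run-beyond (act s x) w L a p h) (act-beyond s x p (<-≤-trans hx h))

act-before : ∀ s x p → suc p < x → act s x p ≡ s p
act-before s (suc k) p (s≤s h) = set₂-below k _ _ s p h

set₂-cong< : ∀ L k {a a' b b'} {s t : Config} → a ≡ a' → b ≡ b' → Agree L s t → Agree L (set₂ k a b s) (set₂ k a' b' t)
set₂-cong< L zero refl refl h zero hp = refl
set₂-cong< L zero refl refl h (suc zero) hp = refl
set₂-cong< L zero refl refl h (suc (suc p)) hp = h _ hp
set₂-cong< L (suc k) refl refl h zero hp = h zero hp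
set₂-cong< (suc L) (suc k) refl refl h (suc p) (s≤s hp) = set₂-cong< L k refl refl (λ q hq → h (suc q) (s≤s hq)) p hp

act-cong< : ∀ L {s t} x → x < L → Agree L s t → Agree L (act s x) (act t x)
act-cong< L zero hx h zero hp = refl
act-cong< L zero hx h (suc p) hp = h (suc p) hp
act-cong< L (suc k) hx h = set₂-cong< L k (cong₂ _⊔_ (h k (<-trans (n<1+n k) hx)) (h (suc k) hx))
                                          (cong₂ _⊓_ (h k (<-trans (n<1+n k) hx)) (h (suc k) hx)) h

run-cong< : ∀ L {s t} w → All (_< L) w → Agree L s t → Agree L (run s w) (run t w)
run-cong< L [] a h = h
run-cong< L (x ∷ w) (hx ∷ a) h = run-cong< L w a (act-cong< L x hx h)

transpose : ℕ → ℕ → ℕ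
transpose k = set₂ k (suc k) k (λ q → q)

set₂-suc : ∀ k a b f p → set₂ k (suc a) (suc b) (λ q → suc (f q)) p ≡ suc (set₂ k a b f p)
set₂-suc zero a b f zero = refl
set₂-suc zero a b f (suc zero) = refl
set₂-suc zero a b f (suc (suc p)) = refl
set₂-suc (suc k) a b f zero = refl
set₂-suc (suc k) a b f (suc p) = set₂-suc k a b (λ q → f (suc q)) p

set₂-transpose : ∀ k s p → set₂ k (s (suc k)) (s k) s p ≡ s (transpose k p)
set₂-transpose zero s zero = refl
set₂-transpose zero s (suc zero) = refl
set₂-transpose zero s (suc (suc p)) = refl
set₂-transpose (suc k) s zero = refl
set₂-transpose (suc k) s (suc p) = trans (set₂-transpose k (λ q → s (suc q)) p) (cong s (sym (set₂-suc k (suc k) k (λ q → q) p)))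

act-sorts : ∀ s k → (act s (suc k) ≗ (λ p → s (transpose k p))) ⊎ (act s (suc k) ≗ s)
act-sorts s k with ≤-total (s k) (s (suc k))
... | inj₁ h = inj₁ (λ p → trans (set₂-cong k (m≤n⇒m⊔n≡n h) (m≤n⇒m⊓n≡m h) (λ _ → refl) p) (set₂-transpose k s p))
... | inj₂ h = inj₂ (λ p → trans (set₂-cong k (m≥n⇒m⊔n≡m h) (m≥n⇒m⊓n≡n h) (λ _ → refl) p) (set₂-self k s p))

transpose-< : ∀ L k p → suc k < L → p < L → transpose k p < L
transpose-< L k p hk hp with set₂-cases k (suc k) k (λ q → q) p
... | inj₁ (_ , e) = subst (_< L) (sym e) hk
... | inj₂ (inj₁ (_ , e)) = subst (_< L) (sym e) (<-trans (n<1+n k) hk)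
... | inj₂ (inj₂ (_ , _ , e)) = subst (_< L) (sym e) hp

transpose-involutive : ∀ k p → transpose k (transpose k p) ≡ p
transpose-involutive k p with set₂-cases k (suc k) k (λ q → q) p
... | inj₁ (refl , e) = trans (cong (transpose k) e) (set₂-at-suc k (suc k) k (λ q → q))
... | inj₂ (inj₁ (refl , e)) = trans (cong (transpose k) e) (set₂-at k (suc k) k (λ q → q))
... | inj₂ (inj₂ (h1 , h2 , e)) = trans (cong (transpose k) e) e

Rook≤-∘ : ∀ {L L' B s} → Rook≤ L' B s → (σ : ℕ → ℕ) → (∀ p → p < L → σ p < L') →
            (∀ p q → p < L → q < L → σ p ≡ σ q → p ≡ q) → Rook≤ L B (λ p → s (σ p))
Rook≤-∘ (rook hb hd) σ hσ hi = rook (λ p hp → hb (σ p) (hσ p hp))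
  (λ p q hp hq h0 e → hi p q hp hq (hd (σ p) (σ q) (hσ p hp) (hσ q hq) h0 e))

Rook≤-resp : ∀ {L B s t} → Agree L s t → Rook≤ L B s → Rook≤ L B t
Rook≤-resp h (rook hb hd) = rook (λ p hp → subst (_≤ _) (h p hp) (hb p hp))
  (λ p q hp hq h0 e → hd p q hp hq (subst (0 <_) (sym (h p hp)) h0) (trans (h p hp) (trans e (sym (h q hq)))))

clear₀-Rook : ∀ {L B s} → Rook≤ L B s → Rook≤ L B (clear₀ s)
clear₀-Rook {L} {B} {s} (rook hb hd) = rook bd ds
  where
  bd : ∀ p → p < L → clear₀ s p ≤ B
  bd zero hp = z≤n
  bd (suc p) hp = hb (suc p) hp
  ds : ∀ p q → p < L → q < L → 0 < clear₀ s p → clear₀ s p ≡ clear₀ s q → p ≡ q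
  ds zero q hp hq () e
  ds (suc p) zero hp hq h0 e = ⊥-elim (<-irrefl (sym e) h0)
  ds (suc p) (suc q) hp hq h0 e = hd (suc p) (suc q) hp hq h0 e

act-Rook : ∀ {L B s} x → x < L → Rook≤ L B s → Rook≤ L B (act s x)
act-Rook zero hx r = clear₀-Rook r
act-Rook {L} {B} {s} (suc k) hx r with act-sorts s k
... | inj₁ e = Rook≤-resp (λ p _ → sym (e p)) (Rook≤-∘ r (transpose k) (λ p hp → transpose-< L k p hx hp)
                 (λ p q _ _ h → trans (sym (transpose-involutive k p)) (trans (cong (transpose k) h) (transpose-involutive k q))))
... | inj₂ e = Rook≤-resp (λ p _ → sym (e p)) r

run-Rook : ∀ {L B s} w → All (_< L) w → Rook≤ L B s → Rook≤ L B (run s w)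
run-Rook [] a r = r
run-Rook (x ∷ w) (hx ∷ a) r = run-Rook w a (act-Rook x hx r)

initial-Rook : ∀ L → Rook L initial
initial-Rook L = rook (λ p hp → hp) (λ p q _ _ _ e → suc-injective e)

-- A canonical word for m + 1 cells extends one for m cells either by moving the new
-- largest token m + 1 to its cell k, or by moving an empty cell to a position j
-- whose predecessors are all occupied.
data Canonical : ℕ → ℕWord → Set where
  canonical-[] : Canonical 0 []
  canonical-down : ∀ {m u} → Canonical m u → ∀ k d → k + d ≡ m → Canonical (suc m) (u ++ down k d)
  canonical-sink : ∀ {m u} → Canonical m u → ∀ j → j ≤ m → Occupied j (run initial u) → Canonical (suc m) (u ++ downSink m j)

All-<-suc : ∀ {m} (w : ℕWord) → All (_< m) w → All (_< suc m) w
All-<-suc w = All.map (λ h → <-trans h (n<1+n _))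

canonical-letters : ∀ {m u} → Canonical m u → All (_< m) u
canonical-letters canonical-[] = []
canonical-letters (canonical-down {m} {u} c k d refl) = ++⁺ (All-<-suc u (canonical-letters c)) (All.map s≤s (down-upper k d))
canonical-letters (canonical-sink {m} {u} c j hj nz) = ++⁺ (All-<-suc u (canonical-letters c))
  (++⁺ (All.map s≤s (down-upper 0 m)) (All.map (λ h → s≤s (≤-trans h hj)) (sink-upper j)))

canonical-empty : ∀ m → Canonical m []
canonical-empty zero = canonical-[]
canonical-empty (suc m) = canonical-down (canonical-empty m) m 0 (+-identityʳ m)

canonical-beyond : ∀ {m u} → Canonical m u → ∀ p → m ≤ p → run initial u p ≡ suc p
canonical-beyond {m} {u} c p h = run-beyond initial u m (canonical-letters c) p h

canonical-Rook : ∀ {m u} → Canonical m u → Rook m (run initial u)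
canonical-Rook {m} {u} c = run-Rook u (canonical-letters c) (initial-Rook m)

insert-cong< : ∀ k a s t B p → k ≤ B → (∀ q → q < B → s q ≡ t q) → p ≤ B → insert k a s p ≡ insert k a t p
insert-cong< k a s t B p hk h hp with <-cmp p k
... | tri< lt _ _ = trans (insert-below k a s p lt) (trans (h p (<-≤-trans lt hk)) (sym (insert-below k a t p lt)))
... | tri≈ _ refl _ = trans (insert-at k a s) (sym (insert-at k a t))
insert-cong< k a s t B (suc p) hk h hp | tri> _ _ gt = trans (insert-above k a s p (≤-pred gt)) (trans (h p hp) (sym (insert-above k a t p (≤-pred gt))))

run-down : ∀ k d s → (∀ p → k ≤ p → p < k + d → s p < s (k + d)) → ∀ p → p ≤ k + d → run s (down k d) p ≡ insert k (s (k + d)) s p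
run-down k zero s h p hp with <-cmp p k
... | tri< lt _ _ = sym (insert-below k _ s p lt)
... | tri≈ _ refl _ = sym (trans (insert-at k _ s) (cong s (+-identityʳ k)))
... | tri> _ _ gt = ⊥-elim (<-irrefl refl (<-≤-trans gt (subst (p ≤_) (+-identityʳ k) hp)))
run-down k (suc e) s h p hp = body
  where
  a' = s (suc (k + e))
  ke = k + e
  eqa : s (k + suc e) ≡ a'
  eqa = cong s (+-suc k e)
  lt : s ke < a'
  lt = subst (s ke <_) eqa (h ke (m≤m+n k e) (+-monoʳ-< k (n<1+n e)))
  t = act s (suc ke)
  te : t ≗ set₂ ke a' (s ke) s
  te = set₂-cong ke (m≤n⇒m⊔n≡n (<⇒≤ lt)) (m≤n⇒m⊓n≡m (<⇒≤ lt)) (λ _ → refl)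
  tke : t ke ≡ a'
  tke = trans (te ke) (set₂-at ke a' (s ke) s)
  tlow : ∀ q → q < ke → t q ≡ s q
  tlow q hq = trans (te q) (set₂-below ke a' (s ke) s q hq)
  hyp : ∀ q → k ≤ q → q < ke → t q < t ke
  hyp q h1 h2 = subst₂ _<_ (sym (tlow q h2)) (sym tke) (subst (s q <_) eqa (h q h1 (<-trans h2 (+-monoʳ-< k (n<1+n e)))))
  ih : ∀ q → q ≤ ke → run t (down k e) q ≡ insert k (t ke) t q
  ih = run-down k e t hyp
  body : run t (down k e) p ≡ insert k (s (k + suc e)) s p
  body with p ≤? ke
  ... | yes hp' = trans (ih p hp') (trans (cong (λ z → insert k z t p) (trans tke (sym eqa)))
                   (insert-cong< k _ t s ke p (m≤m+n k e) tlow hp'))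
  ... | no np = trans (run-beyond t (down k e) (suc ke) (All.map s≤s (down-upper k e)) p pe)
                 (trans (cong t (sym p≡)) (trans (te (suc ke)) (trans (set₂-at-suc ke a' (s ke) s)
                 (trans (sym (insert-above k _ s ke (m≤m+n k e))) (cong (insert k _ s) p≡)))))
    where
    pe : suc ke ≤ p
    pe = ≰⇒> np
    p≡ : suc ke ≡ p
    p≡ = ≤-antisym pe (subst (p ≤_) (+-suc k e) hp)

run-up : ∀ j U p → run (insert 0 0 U) (up j) p ≡ insert j 0 U p
run-up zero U p = refl
run-up (suc i) U p =
  trans (cong (λ z → z p) (run-++ (insert 0 0 U) (up i) [ suc i ]))
  (trans (act-cong (suc i) (run-up i U) p)
  (trans (set₂-cong i (cong₂ _⊔_ (insert-at i 0 U) (insert-above i 0 U i ≤-refl)) (cong₂ _⊓_ (insert-at i 0 U) (insert-above i 0 U i ≤-refl)) (λ _ → refl) p)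
  fin))
  where
  V = insert i 0 U
  fin : set₂ i (0 ⊔ U i) (0 ⊓ U i) V p ≡ insert (suc i) 0 U p
  fin with set₂-cases i (0 ⊔ U i) (0 ⊓ U i) V p
  ... | inj₁ (refl , e) = trans e (sym (insert-below (suc i) 0 U i (n<1+n i)))
  ... | inj₂ (inj₁ (refl , e)) = trans e (sym (insert-at (suc i) 0 U))
  ... | inj₂ (inj₂ (h1 , h2 , e)) = trans e (g p h1 h2)
    where
    g : ∀ p → p ≢ i → p ≢ suc i → insert i 0 U p ≡ insert (suc i) 0 U p
    g p h1 h2 with <-cmp p i
    ... | tri< lt _ _ = trans (insert-below i 0 U p lt) (sym (insert-below (suc i) 0 U p (<-trans lt (n<1+n i))))
    ... | tri≈ _ e _ = ⊥-elim (h1 e)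
    g (suc p) h1 h2 | tri> _ _ gt = trans (insert-above i 0 U p (≤-pred gt))
        (sym (insert-above (suc i) 0 U p (≤∧≢⇒< (≤-pred gt) (λ e → h2 (cong suc (sym e))))))

run-canonical-down : ∀ {m u} → Canonical m u → ∀ k d → k + d ≡ m → Agree (suc m) (run initial (u ++ down k d)) (insert k (suc m) (run initial u))
run-canonical-down {m} {u} c k d refl p hp =
  trans (cong (λ z → z p) (run-++ initial u (down k d)))
  (trans (run-down k d U hyp p (≤-pred hp)) (cong (λ z → insert k z U p) (canonical-beyond c (k + d) ≤-refl)))
  where
  U = run initial u
  hyp : ∀ q → k ≤ q → q < k + d → U q < U (k + d)
  hyp q _ hq = subst (U q <_) (sym (canonical-beyond c (k + d) ≤-refl)) (s≤s (Rook≤.bounded (canonical-Rook c) q hq))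

run-canonical-sink : ∀ {m u} → Canonical m u → ∀ j → j ≤ m → Agree (suc m) (run initial (u ++ downSink m j)) (insert j 0 (run initial u))
run-canonical-sink {m} {u} c j hj p hp =
  trans (cong (λ z → z p) (run-++ initial u (downSink m j)))
  (trans (cong (λ z → z p) (run-++ U (down 0 m) (sink j)))
  (trans (run-cong< (suc m) (up j) (All.map (λ h → s≤s (≤-trans h hj)) (up-upper j)) e2 p hp)
  (run-up j U p)))
  where
  U = run initial u
  t1 = run U (down 0 m)
  hyp : ∀ q → 0 ≤ q → q < m → U q < U m
  hyp q _ hq = subst (U q <_) (sym (canonical-beyond c m ≤-refl)) (s≤s (Rook≤.bounded (canonical-Rook c) q hq))
  e1 : Agree (suc m) t1 (insert 0 (U m) U)
  e1 q hq = run-down 0 m U hyp q (≤-pred hq)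
  e2 : Agree (suc m) (clear₀ t1) (insert 0 0 U)
  e2 zero hq = refl
  e2 (suc q) hq = e1 (suc q) hq

insert-bounded : ∀ k a U B L p → k ≤ L → a ≤ B → (∀ q → q < L → U q ≤ B) → p ≤ L → insert k a U p ≤ B
insert-bounded k a U B L p hk ha hU hp with <-cmp p k
... | tri< lt _ _ = subst (_≤ B) (sym (insert-below k a U p lt)) (hU p (<-≤-trans lt hk))
... | tri≈ _ refl _ = subst (_≤ B) (sym (insert-at k a U)) ha
insert-bounded k a U B L (suc p) hk ha hU hp | tri> _ _ gt = subst (_≤ B) (sym (insert-above k a U p (≤-pred gt))) (hU p hp)

insert-injective : ∀ L k1 k2 a U1 U2 → k1 ≤ L → k2 ≤ L → (∀ p → p < k1 → U1 p ≢ a) → (∀ p → p < k2 → U2 p ≢ a) →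
         (∀ p → p ≤ L → insert k1 a U1 p ≡ insert k2 a U2 p) → k1 ≡ k2 × Agree L U1 U2
insert-injective L k1 k2 a U1 U2 h1 h2 n1 n2 e with <-cmp k1 k2
... | tri< lt _ _ = ⊥-elim (n2 k1 lt (trans (sym (insert-below k2 a U2 k1 lt)) (trans (sym (e k1 h1)) (insert-at k1 a U1))))
... | tri> _ _ gt = ⊥-elim (n1 k2 gt (trans (sym (insert-below k1 a U1 k2 gt)) (trans (e k2 h2) (insert-at k2 a U2))))
... | tri≈ _ refl _ = refl , f
  where
  f : Agree L U1 U2
  f p hp with <-cmp p k1
  ... | tri< lt _ _ = trans (sym (insert-below k1 a U1 p lt)) (trans (e p (<⇒≤ hp)) (insert-below k1 a U2 p lt))
  ... | tri≈ _ eq _ = trans (sym (insert-above k1 a U1 p (≤-reflexive (sym eq)))) (trans (e (suc p) hp) (insert-above k1 a U2 p (≤-reflexive (sym eq))))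
  ... | tri> _ _ gt = trans (sym (insert-above k1 a U1 p (<⇒≤ gt))) (trans (e (suc p) hp) (insert-above k1 a U2 p (<⇒≤ gt)))

canonical-injective : ∀ m {d1 d2} → Canonical m d1 → Canonical m d2 →
                      Agree m (run initial d1) (run initial d2) → d1 ≡ d2
canonical-injective zero canonical-[] canonical-[] e = refl
canonical-injective (suc m) (canonical-down {u = u1} c1 k1 d1 e1) (canonical-down {u = u2} c2 k2 d2 e2) e =
  cong₂ (λ u l → u ++ l) ueq (cong₂ down keq deq)
  where
  U1 = run initial u1
  U2 = run initial u2
  hk1 = subst (k1 ≤_) e1 (m≤m+n k1 d1)
  hk2 = subst (k2 ≤_) e2 (m≤m+n k2 d2)
  E : ∀ p → p ≤ m → insert k1 (suc m) U1 p ≡ insert k2 (suc m) U2 p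
  E p hp = trans (sym (run-canonical-down c1 k1 d1 e1 p (s≤s hp))) (trans (e p (s≤s hp)) (run-canonical-down c2 k2 d2 e2 p (s≤s hp)))
  n1 : ∀ p → p < k1 → U1 p ≢ suc m
  n1 p hp q = <-irrefl refl (subst (_≤ m) q (Rook≤.bounded (canonical-Rook c1) p (<-≤-trans hp hk1)))
  n2 : ∀ p → p < k2 → U2 p ≢ suc m
  n2 p hp q = <-irrefl refl (subst (_≤ m) q (Rook≤.bounded (canonical-Rook c2) p (<-≤-trans hp hk2)))
  inserted = insert-injective m k1 k2 (suc m) U1 U2 hk1 hk2 n1 n2 E
  keq = proj₁ inserted
  ueq = canonical-injective m c1 c2 (proj₂ inserted)
  deq : d1 ≡ d2
  deq = +-cancelˡ-≡ k1 d1 d2 (trans e1 (trans (sym e2) (cong (_+ d2) (sym keq))))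
canonical-injective (suc m) (canonical-sink {u = u1} c1 j1 hj1 nz1) (canonical-sink {u = u2} c2 j2 hj2 nz2) e =
  cong₂ (λ u j → u ++ downSink m j) ueq jeq
  where
  U1 = run initial u1
  U2 = run initial u2
  E : ∀ p → p ≤ m → insert j1 0 U1 p ≡ insert j2 0 U2 p
  E p hp = trans (sym (run-canonical-sink c1 j1 hj1 p (s≤s hp))) (trans (e p (s≤s hp)) (run-canonical-sink c2 j2 hj2 p (s≤s hp)))
  n1 : ∀ p → p < j1 → U1 p ≢ 0
  n1 p hp q = <-irrefl refl (subst (0 <_) q (nz1 p hp))
  n2 : ∀ p → p < j2 → U2 p ≢ 0
  n2 p hp q = <-irrefl refl (subst (0 <_) q (nz2 p hp))
  inserted = insert-injective m j1 j2 0 U1 U2 hj1 hj2 n1 n2 E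
  jeq = proj₁ inserted
  ueq = canonical-injective m c1 c2 (proj₂ inserted)
canonical-injective (suc m) (canonical-down {u = u1} c1 k1 d1 e1) (canonical-sink {u = u2} c2 j2 hj2 nz2) e =
  ⊥-elim (<-irrefl refl (subst (_≤ m) (sym X) (insert-bounded j2 0 (run initial u2) m m k1 hj2 z≤n (Rook≤.bounded (canonical-Rook c2)) hk1)))
  where
  hk1 = subst (k1 ≤_) e1 (m≤m+n k1 d1)
  X : suc m ≡ insert j2 0 (run initial u2) k1
  X = trans (sym (insert-at k1 (suc m) (run initial u1))) (trans (sym (run-canonical-down c1 k1 d1 e1 k1 (s≤s hk1))) (trans (e k1 (s≤s hk1)) (run-canonical-sink c2 j2 hj2 k1 (s≤s hk1))))
canonical-injective (suc m) (canonical-sink {u = u1} c1 j1 hj1 nz1) (canonical-down {u = u2} c2 k2 d2 e2) e =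
  ⊥-elim (<-irrefl refl (subst (_≤ m) (sym X) (insert-bounded j1 0 (run initial u1) m m k2 hj1 z≤n (Rook≤.bounded (canonical-Rook c1)) hk2)))
  where
  hk2 = subst (k2 ≤_) e2 (m≤m+n k2 d2)
  X : suc m ≡ insert j1 0 (run initial u1) k2
  X = trans (sym (insert-at k2 (suc m) (run initial u2))) (trans (sym (run-canonical-down c2 k2 d2 e2 k2 (s≤s hk2))) (trans (sym (e k2 (s≤s hk2))) (run-canonical-sink c1 j1 hj1 k2 (s≤s hk2))))

find-value : ∀ (r : Config) v L → (∃ λ p → p < L × r p ≡ v) ⊎ (∀ p → p < L → r p ≢ v)
find-value r v zero = inj₂ (λ p ())
find-value r v (suc L) with find-value r v L
... | inj₁ (p , hp , e) = inj₁ (p , <-trans hp (n<1+n L) , e)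
... | inj₂ n with r L ≟ v
...   | yes e = inj₁ (L , n<1+n L , e)
...   | no ne = inj₂ f
  where
  f : ∀ p → p < suc L → r p ≢ v
  f p hp with <-cmp p L
  ... | tri< lt _ _ = n p lt
  ... | tri≈ _ refl _ = ne
  ... | tri> _ _ gt = ⊥-elim (<-irrefl refl (<-≤-trans gt (≤-pred hp)))

find-empty : ∀ (r : Config) L → (∃ λ j → j < L × r j ≡ 0 × Occupied j r) ⊎ Occupied L r
find-empty r zero = inj₂ (λ p ())
find-empty r (suc L) with find-empty r L
... | inj₁ (j , hj , e , nz) = inj₁ (j , <-trans hj (n<1+n L) , e , nz)
... | inj₂ nz with r L ≟ 0
...   | yes e = inj₁ (L , n<1+n L , e , nz)
...   | no ne = inj₂ f
  where
  f : Occupied (suc L) r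
  f p hp with <-cmp p L
  ... | tri< lt _ _ = nz p lt
  ... | tri≈ _ refl _ = n≢0⇒n>0 ne
  ... | tri> _ _ gt = ⊥-elim (<-irrefl refl (<-≤-trans gt (≤-pred hp)))

delete-suc : ∀ k (f : Config) p → delete k (λ q → suc (f q)) p ≡ suc (delete k f p)
delete-suc zero f p = refl
delete-suc (suc k) f zero = refl
delete-suc (suc k) f (suc p) = delete-suc k (λ q → f (suc q)) p

delete-skip : ∀ k (s : Config) p → delete k s p ≡ s (delete k (λ q → q) p)
delete-skip zero s p = refl
delete-skip (suc k) s zero = refl
delete-skip (suc k) s (suc p) = trans (delete-skip k (λ q → s (suc q)) p) (cong s (sym (delete-suc k (λ q → q) p)))

insert-delete : ∀ k (s : Config) p → insert k (s k) (delete k s) p ≡ s p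
insert-delete zero s zero = refl
insert-delete zero s (suc p) = refl
insert-delete (suc k) s zero = refl
insert-delete (suc k) s (suc p) = insert-delete k (λ q → s (suc q)) p

skip : ℕ → ℕ → ℕ
skip k = delete k (λ q → q)

skip-cases : ∀ k p → (p < k × skip k p ≡ p) ⊎ (k ≤ p × skip k p ≡ suc p)
skip-cases k p with <-cmp p k
... | tri< lt _ _ = inj₁ (lt , delete-below k _ p lt)
... | tri≈ _ e _ = inj₂ (≤-reflexive (sym e) , delete-above k _ p (≤-reflexive (sym e)))
... | tri> _ _ gt = inj₂ (<⇒≤ gt , delete-above k _ p (<⇒≤ gt))

skip-injective : ∀ k p q → skip k p ≡ skip k q → p ≡ q
skip-injective k p q e with skip-cases k p | skip-cases k q
... | inj₁ (_ , a) | inj₁ (_ , b) = trans (sym a) (trans e b)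
... | inj₂ (_ , a) | inj₂ (_ , b) = suc-injective (trans (sym a) (trans e b))
... | inj₁ (hp , a) | inj₂ (hq , b) = ⊥-elim (<-irrefl refl (<-≤-trans hp (≤-trans hq (subst (q ≤_) (sym peq) (n≤1+n q)))))
  where peq : p ≡ suc q
        peq = trans (sym a) (trans e b)
... | inj₂ (hp , a) | inj₁ (hq , b) = ⊥-elim (<-irrefl refl (<-≤-trans hq (≤-trans hp (subst (p ≤_) (sym qeq) (n≤1+n p)))))
  where qeq : q ≡ suc p
        qeq = trans (sym b) (trans (sym e) a)

skip-≢ : ∀ k p → skip k p ≢ k
skip-≢ k p e with skip-cases k p
... | inj₁ (hp , a) = <-irrefl (trans (sym a) e) hp
... | inj₂ (hp , a) = <-irrefl refl (subst (_≤ p) (sym (trans (sym a) e)) hp)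

skip-< : ∀ m k p → p < m → skip k p < suc m
skip-< m k p hp with skip-cases k p
... | inj₁ (_ , a) = subst (_< suc m) (sym a) (<-trans hp (n<1+n m))
... | inj₂ (_ , a) = subst (_< suc m) (sym a) (s≤s hp)

Rook-delete : ∀ m r k → Rook (suc m) r → (∀ q → q < suc m → q ≢ k → r q ≢ suc m) → Rook m (delete k r)
Rook-delete m r k (rook hb hd) nv = rook bd ds
  where
  bd : ∀ p → p < m → delete k r p ≤ m
  bd p hp = subst (_≤ m) (sym (delete-skip k r p))
    (≤-pred (≤∧≢⇒< (hb (skip k p) (skip-< m k p hp)) (nv (skip k p) (skip-< m k p hp) (skip-≢ k p))))
  ds : ∀ p q → p < m → q < m → 0 < delete k r p → delete k r p ≡ delete k r q → p ≡ q
  ds p q hp hq h0 e = skip-injective k p q (hd (skip k p) (skip k q) (skip-< m k p hp) (skip-< m k q hq)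
       (subst (0 <_) (delete-skip k r p) h0) (trans (sym (delete-skip k r p)) (trans e (delete-skip k r q))))

rook-pigeonhole : ∀ m (r : Config) → Occupied (suc m) r → ¬ Rook≤ (suc m) m r
rook-pigeonhole m r nz (rook bd ds) with FP.pigeonhole (n<1+n m) f
  where
  lt : ∀ p → p < suc m → pred (r p) < m
  lt p hp with r p | nz p hp | bd p hp
  ... | suc x | _ | h = h
  f : Fin (suc m) → Fin m
  f i = fromℕ< (lt (toℕ i) (FP.toℕ<n i))
... | i , j , i<j , e = <-irrefl (ds (toℕ i) (toℕ j) (FP.toℕ<n i) (FP.toℕ<n j) (nz (toℕ i) (FP.toℕ<n i)) req) i<j
  where
  pe : pred (r (toℕ i)) ≡ pred (r (toℕ j))
  pe = trans (sym (FP.toℕ-fromℕ< _)) (trans (cong toℕ e) (FP.toℕ-fromℕ< _))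
  pinj : ∀ a b → 0 < a → 0 < b → pred a ≡ pred b → a ≡ b
  pinj (suc a) (suc b) _ _ h = cong suc h
  req = pinj _ _ (nz (toℕ i) (FP.toℕ<n i)) (nz (toℕ j) (FP.toℕ<n j)) pe

Rook-moveToFront : ∀ {m U} j → j < m → Rook m U → Rook m (insert 0 (U j) (delete j U))
Rook-moveToFront {m} {U} j j<m r = Rook≤-resp agree (Rook≤-∘ r σ σ-< σ-injective)
  where
  σ : ℕ → ℕ
  σ = insert 0 j (skip j)
  agree : Agree m (U ∘ σ) (insert 0 (U j) (delete j U))
  agree zero    _ = refl
  agree (suc p) _ = sym (delete-skip j U p)
  σ-< : ∀ p → p < m → σ p < m
  σ-< zero    _ = j<m
  σ-< (suc p) p+1<m with skip-cases j p
  ... | inj₁ (_ , e) = subst (_< m) (sym e) (<-trans (n<1+n p) p+1<m)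
  ... | inj₂ (_ , e) = subst (_< m) (sym e) p+1<m
  σ-injective : ∀ p q → p < m → q < m → σ p ≡ σ q → p ≡ q
  σ-injective zero    zero    _ _ _ = refl
  σ-injective zero    (suc q) _ _ e = ⊥-elim (skip-≢ j q (sym e))
  σ-injective (suc p) zero    _ _ e = ⊥-elim (skip-≢ j p e)
  σ-injective (suc p) (suc q) _ _ e = cong suc (skip-injective j p q e)

-- Remove the largest token m + 1 if present, and otherwise the first empty cell,
-- which exists by the pigeonhole principle.
canonical-surjective : ∀ m r → Rook m r → ∃ λ d → Canonical m d × Agree m (run initial d) r
canonical-surjective zero r hr = [] , canonical-[] , (λ p ())
canonical-surjective (suc m) r hr with find-value r (suc m) (suc m)
... | inj₁ (k , hk , ek) = (u ++ down k (m ∸ k)) , canonical-down cu k (m ∸ k) ke , E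
  where
  nv : ∀ q → q < suc m → q ≢ k → r q ≢ suc m
  nv q hq ne e = ne (Rook≤.injective hr q k hq hk (subst (0 <_) (sym e) (s≤s z≤n)) (trans e (sym ek)))
  U = delete k r
  IH = canonical-surjective m U (Rook-delete m r k hr nv)
  u = proj₁ IH
  cu = proj₁ (proj₂ IH)
  eu = proj₂ (proj₂ IH)
  km : k ≤ m
  km = ≤-pred hk
  ke : k + (m ∸ k) ≡ m
  ke = m+[n∸m]≡n km
  E : Agree (suc m) (run initial (u ++ down k (m ∸ k))) r
  E p hp = trans (run-canonical-down cu k (m ∸ k) ke p hp)
           (trans (insert-cong< k (suc m) (run initial u) U m p km eu (≤-pred hp))
           (trans (cong (λ z → insert k z U p) (sym ek)) (insert-delete k r p)))
... | inj₂ nv with find-empty r (suc m)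
...   | inj₁ (j , hj , ej , nzj) = (u ++ downSink m j) , canonical-sink cu j jm nzu , E
  where
  U = delete j r
  IH = canonical-surjective m U (Rook-delete m r j hr (λ q hq _ → nv q hq))
  u = proj₁ IH
  cu = proj₁ (proj₂ IH)
  eu = proj₂ (proj₂ IH)
  jm : j ≤ m
  jm = ≤-pred hj
  nzu : Occupied j (run initial u)
  nzu p hp = subst (0 <_) (sym (trans (eu p (<-≤-trans hp jm)) (delete-below j r p hp))) (nzj p hp)
  E : Agree (suc m) (run initial (u ++ downSink m j)) r
  E p hp = trans (run-canonical-sink cu j jm p hp)
           (trans (insert-cong< j 0 (run initial u) U m p jm eu (≤-pred hp))
           (trans (cong (λ z → insert j z U p) (sym ej)) (insert-delete j r p)))
...   | inj₂ occ = ⊥-elim (rook-pigeonhole m r occ (rook (λ p p<m+1 → ≤-pred (≤∧≢⇒< (Rook≤.bounded hr p p<m+1) (nv p p<m+1)))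
                                                       (Rook≤.injective hr)))

Normalizes : ℕ → Set
Normalizes m = ∀ w → All (_< m) w → ∃ λ d → Canonical m d × w ≈ d

Faithful : ℕ → Set
Faithful m = ∀ w1 w2 → All (_< m) w1 → All (_< m) w2 → Agree m (run initial w1) (run initial w2) → w1 ≈ w2

normalizes⇒faithful : ∀ m → Normalizes m → Faithful m
normalizes⇒faithful m nm w1 w2 a1 a2 e with nm w1 a1 | nm w2 a2
... | d1 , c1 , q1 | d2 , c2 , q2 = ≈-trans q1 (subst (λ z → z ≈ w2) (sym deq) (≈-sym q2))
  where
  E : Agree m (run initial d1) (run initial d2)
  E p hp = trans (sym (≈⇒run≗ q1 initial p)) (trans (e p hp) (≈⇒run≗ q2 initial p))
  deq : d1 ≡ d2
  deq = canonical-injective m c1 c2 E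

run-≈ : ∀ u v {u′ : ℕWord} → (u ++ v) ≈ u′ → ∀ p → run initial u′ p ≡ run (run initial u) v p
run-≈ u v u·v≈u′ p = trans (sym (≈⇒run≗ u·v≈u′ initial p)) (run-++-at initial u v p)

⊓-positive : ∀ {a b} → 0 < a → 0 < b → 0 < a ⊓ b
⊓-positive {suc a} {suc b} _ _ = s≤s z≤n

⊔-positive : ∀ {a b} → 0 < a → 0 < a ⊔ b
⊔-positive {a} {b} 0<a = ≤-trans 0<a (m≤m⊔n a b)

Occupied-resp : ∀ {j s t} → (∀ p → s p ≡ t p) → Occupied j s → Occupied j t
Occupied-resp s≗t occ p p<j = subst (0 <_) (s≗t p) (occ p p<j)

Occupied-suc : ∀ {j s} → Occupied j s → s j ≢ 0 → Occupied (suc j) s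
Occupied-suc {j} occ sj≢0 p p<j+1 with <-cmp p j
... | tri< p<j _ _ = occ p p<j
... | tri≈ _ refl _ = n≢0⇒n>0 sj≢0
... | tri> _ _ p>j = ⊥-elim (<-irrefl refl (<-≤-trans p>j (≤-pred p<j+1)))

act-Occupied-inside : ∀ {j s} y → suc y < j → Occupied j s → Occupied j (act s (suc y))
act-Occupied-inside {j} {s} y y+1<j occ p p<j with set₂-cases y (s y ⊔ s (suc y)) (s y ⊓ s (suc y)) s p
... | inj₁ (_ , e)             = subst (0 <_) (sym e) (⊔-positive (occ y (<-trans (n<1+n y) y+1<j)))
... | inj₂ (inj₁ (_ , e))      = subst (0 <_) (sym e) (⊓-positive (occ y (<-trans (n<1+n y) y+1<j)) (occ (suc y) y+1<j))
... | inj₂ (inj₂ (_ , _ , e))  = subst (0 <_) (sym e) (occ p p<j)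

act-Occupied-outside : ∀ {j s} x → j < x → Occupied j s → Occupied j (act s x)
act-Occupied-outside {s = s} x j<x occ p p<j =
  subst (0 <_) (sym (act-before s x p (≤-trans (s≤s p<j) j<x))) (occ p p<j)

-- Induction step: normal forms on m cells, and the faithfulness they imply, give
-- normal forms on m + 1 cells.
module Closure (m : ℕ) (normalizes-m : Normalizes m) (faithful-m : Faithful m) where

  Snoc : ℕWord → ℕ → Set
  Snoc d x = ∃ λ d′ → Canonical (suc m) d′ × ((d ++ [ x ]) ≈ d′)

  pushed : ∀ {u} → Canonical m u → ∀ t {x} v {t′} → All (_< m) v → (t ++ [ x ]) ≈ (v ++ t′) →
           ∃ λ u′ → Canonical m u′ × ((u ++ v) ≈ u′) × (((u ++ t) ++ [ x ]) ≈ (u′ ++ t′))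
  pushed {u} c t {x} v {t′} v<m t·x≈v·t′ with normalizes-m (u ++ v) (++⁺ (canonical-letters c) v<m)
  ... | u′ , c′ , u·v≈u′ = u′ , c′ , u·v≈u′ , (begin
    (u ++ t) ++ [ x ]  ≡⟨ ++-assoc u t [ x ] ⟩
    u ++ (t ++ [ x ])  ≈⟨ ≈-congˡ u t·x≈v·t′ ⟩
    u ++ (v ++ t′)     ≡⟨ sym (++-assoc u v t′) ⟩
    (u ++ v) ++ t′     ≈⟨ ≈-congʳ t′ u·v≈u′ ⟩
    u′ ++ t′           ∎)

  absorbed : ∀ u t {x} → (t ++ [ x ]) ≈ t → ((u ++ t) ++ [ x ]) ≈ (u ++ t)
  absorbed u t {x} t·x≈t = ≈-trans (≡⇒≈ (++-assoc u t [ x ])) (≈-congˡ u t·x≈t)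

  extended : ∀ (u t : ℕWord) {x t′} → t ++ [ x ] ≡ t′ → ((u ++ t) ++ [ x ]) ≡ (u ++ t′)
  extended u t {x} t·x≡t′ = trans (++-assoc u t [ x ]) (cong (u ++_) t·x≡t′)

  snoc-down : ∀ {u} → Canonical m u → ∀ k e → k + e ≡ m → ∀ x → x ≤ m → Snoc (u ++ down k e) x
  snoc-down {u} c k e ke x x≤m with <-cmp x k
  ... | tri< x<k _ _ with pushed c (down k e) [ x ] (<-≤-trans x<k (subst (k ≤_) ke (m≤m+n k e)) ∷ [])
                                                   (down-pass k e x x<k)
  ...   | u′ , c′ , _ , eq = u′ ++ down k e , canonical-down c′ k e ke , eq
  snoc-down {u} c zero e ke .zero _ | tri≈ _ refl _ =
    u ++ downSink m 0 , canonical-sink c 0 z≤n (λ _ ()) ,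
    ≡⇒≈ (extended u (down 0 e) (cong (λ e → down 0 e ++ [ 0 ]) ke))
  snoc-down {u} c (suc k) e ke .(suc k) _ | tri≈ _ refl _ =
    u ++ down k (suc e) , canonical-down c k (suc e) (trans (+-suc k e) ke) ,
    ≡⇒≈ (extended u (down (suc k) e) (down-snoc k e))
  snoc-down {u} c k e ke x x≤m | tri> _ _ x>k with <-cmp x (suc k)
  ... | tri< x<k+1 _ _ = ⊥-elim (<-irrefl refl (<-≤-trans x>k (≤-pred x<k+1)))
  snoc-down {u} c k zero ke x x≤m | tri> _ _ _ | tri≈ _ refl _ =
    ⊥-elim (<-irrefl refl (≤-trans x≤m (≤-reflexive (trans (sym ke) (+-identityʳ k)))))
  snoc-down {u} c k (suc e) ke x x≤m | tri> _ _ _ | tri≈ _ refl _ =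
    u ++ down k (suc e) , canonical-down c k (suc e) ke , absorbed u (down k (suc e)) (down-absorb k e)
  snoc-down {u} c k e ke (suc y) y<m | tri> _ _ _ | tri> _ _ y>k
    with pushed c (down k e) [ y ] (y<m ∷ []) (down-shift k e y (≤-pred y>k) (subst (y <_) (sym ke) y<m))
  ... | u′ , c′ , _ , eq = u′ ++ down k e , canonical-down c′ k e ke , eq

  ends-with-sink : ∀ {u} → Canonical m u → ∀ j → j < m → run initial u j ≡ 0 → ∃ λ v → u ≈ (v ++ sink j)
  ends-with-sink {u} c j j<m uj≡0 =
    v , faithful-m u (v ++ sink j) (canonical-letters c) (++⁺ (canonical-letters cv) sink<m) agree
    where
    U = run initial u
    V = delete j U
    front : Rook m (insert 0 0 V)
    front = subst (λ a → Rook m (insert 0 a V)) uj≡0 (Rook-moveToFront j j<m (canonical-Rook c))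
    v = proj₁ (canonical-surjective m (insert 0 0 V) front)
    cv = proj₁ (proj₂ (canonical-surjective m (insert 0 0 V) front))
    v≗ = proj₂ (proj₂ (canonical-surjective m (insert 0 0 V) front))
    sink<m : All (_< m) (sink j)
    sink<m = All.map (λ i≤j → ≤-<-trans i≤j j<m) (sink-upper j)
    cleared : clear₀ (insert 0 0 V) ≗ insert 0 0 V
    cleared zero    = refl
    cleared (suc p) = refl
    agree : Agree m U (run initial (v ++ sink j))
    agree p p<m = sym (trans (run-++-at initial v (sink j) p)
                      (trans (run-cong< m (sink j) sink<m v≗ p p<m)
                      (trans (run-cong (up j) cleared p)
                      (trans (run-up j V p)
                      (trans (cong (λ a → insert j a V p) (sym uj≡0)) (insert-delete j U p))))))

  snoc-sink : ∀ {u} → Canonical m u → ∀ j → j ≤ m → Occupied j (run initial u) → ∀ x → x ≤ m →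
              Snoc (u ++ downSink m j) x
  snoc-sink {u} c j j≤m occ x x≤m with <-cmp x j
  snoc-sink {u} c (suc i) i<m occ zero _ | tri< _ _ _
    with pushed c (downSink m (suc i)) (sink i) (All.map (λ k≤i → <-≤-trans (s≤s k≤i) i<m) (sink-upper i))
                (downSink-π₀ m i i<m)
  ... | u′ , c′ , _ , eq = u′ ++ downSink m 0 , canonical-sink c′ 0 z≤n (λ _ ()) , eq
  snoc-sink {u} c j j≤m occ (suc y) _ | tri< y+1<j _ _
    with pushed c (downSink m j) [ suc y ] (<-≤-trans y+1<j j≤m ∷ []) (downSink-shift-below m j (suc y) (s≤s z≤n) y+1<j j≤m)
  ... | u′ , c′ , u·y≈u′ , eq =
    u′ ++ downSink m j ,
    canonical-sink c′ j j≤m (Occupied-resp (sym ∘ run-≈ u [ suc y ] u·y≈u′) (act-Occupied-inside y y+1<j occ)) , eq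
  snoc-sink {u} c j j≤m occ .j _ | tri≈ _ refl _ =
    u ++ downSink m j , canonical-sink c j j≤m occ , absorbed u (downSink m j) (downSink-absorb m j)
  snoc-sink {u} c j j≤m occ x x≤m | tri> _ _ x>j with <-cmp x (suc j)
  ... | tri< x<j+1 _ _ = ⊥-elim (<-irrefl refl (<-≤-trans x>j (≤-pred x<j+1)))
  ... | tri≈ _ refl _ with run initial u j ≟ 0
  ...   | no uj≢0 =
    u ++ downSink m (suc j) , canonical-sink c (suc j) x≤m (Occupied-suc occ uj≢0) ,
    ≡⇒≈ (extended u (downSink m j) (downSink-snoc m j))
  ...   | yes uj≡0 with ends-with-sink c j x≤m uj≡0
  ...     | v , u≈v·sink = u ++ downSink m j , canonical-sink c j j≤m occ , (begin
    (u ++ downSink m j) ++ [ suc j ]               ≡⟨ ++-assoc u _ _ ⟩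
    u ++ (downSink m j ++ [ suc j ])               ≈⟨ ≈-congʳ (downSink m j ++ [ suc j ]) u≈v·sink ⟩
    (v ++ sink j) ++ (downSink m j ++ [ suc j ])   ≡⟨ ++-assoc v (sink j) _ ⟩
    v ++ (sink j ++ downSink m j ++ [ suc j ])     ≈⟨ ≈-congˡ v (sink-downSink-absorb m j x≤m) ⟩
    v ++ (sink j ++ downSink m j)                  ≡⟨ sym (++-assoc v (sink j) _) ⟩
    (v ++ sink j) ++ downSink m j                  ≈⟨ ≈-congʳ (downSink m j) (≈-sym u≈v·sink) ⟩
    u ++ downSink m j                              ∎)
  snoc-sink {u} c j j≤m occ (suc y) y<m | tri> _ _ _ | tri> _ _ y>j
    with pushed c (downSink m j) [ y ] (y<m ∷ []) (downSink-shift-above m j (suc y) y>j y<m)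
  ... | u′ , c′ , u·y≈u′ , eq =
    u′ ++ downSink m j ,
    canonical-sink c′ j j≤m (Occupied-resp (sym ∘ run-≈ u [ y ] u·y≈u′) (act-Occupied-outside y (≤-pred y>j) occ)) , eq

  snoc-canonical : ∀ {d} → Canonical (suc m) d → ∀ x → x ≤ m → Snoc d x
  snoc-canonical (canonical-down c k e ke)     = snoc-down c k e ke
  snoc-canonical (canonical-sink c j j≤m occ)  = snoc-sink c j j≤m occ

  normalize-from : ∀ {d} w → Canonical (suc m) d → All (_< suc m) w →
                   ∃ λ d′ → Canonical (suc m) d′ × (d ++ w) ≈ d′
  normalize-from {d} [] c [] = d , c , ≡⇒≈ (++-identityʳ d)
  normalize-from {d} (x ∷ w) c (x<m+1 ∷ w<m+1) with snoc-canonical c x (≤-pred x<m+1)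
  ... | d₁ , c₁ , d·x≈d₁ with normalize-from w c₁ w<m+1
  ...   | d₂ , c₂ , d₁·w≈d₂ = d₂ , c₂ , ≈-trans (≡⇒≈ (sym (++-assoc d [ x ] w))) (≈-trans (≈-congʳ w d·x≈d₁) d₁·w≈d₂)

normalize : ∀ m → Normalizes m
normalize zero    []      []       = [] , canonical-[] , ≈-refl
normalize zero    (x ∷ w) (() ∷ _)
normalize (suc m) w w<m+1 =
  Closure.normalize-from m (normalize m) (normalizes⇒faithful m (normalize m)) w (canonical-empty (suc m)) w<m+1

faithful : ∀ m → Faithful m
faithful m = normalizes⇒faithful m (normalize m)

total : ℕ → Config → ℕ
total zero s = 0
total (suc L) s = s 0 + total L (λ q → s (suc q))

-- potential L s = Σ_(p<L) (p + 1) · s p, which drops whenever a letter changes s.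
potential : ℕ → Config → ℕ
potential zero s = 0
potential (suc L) s = total (suc L) s + potential L (λ q → s (suc q))

total-cong : ∀ L {s t} → Agree L s t → total L s ≡ total L t
total-cong zero h = refl
total-cong (suc L) h = cong₂ _+_ (h 0 (s≤s z≤n)) (total-cong L (λ q hq → h (suc q) (s≤s hq)))

potential-cong : ∀ L {s t} → Agree L s t → potential L s ≡ potential L t
potential-cong zero h = refl
potential-cong (suc L) h = cong₂ _+_ (total-cong (suc L) h) (potential-cong L (λ q hq → h (suc q) (s≤s hq)))

⊔+⊓≡+ : ∀ a b → a ⊔ b + a ⊓ b ≡ a + b
⊔+⊓≡+ zero b = +-identityʳ b
⊔+⊓≡+ (suc a) zero = refl
⊔+⊓≡+ (suc a) (suc b) = cong suc (trans (+-suc (a ⊔ b) (a ⊓ b)) (trans (cong suc (⊔+⊓≡+ a b)) (sym (+-suc a b))))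

total-sort : ∀ L k s → suc k < L → total L (act s (suc k)) ≡ total L s
total-sort (suc (suc L)) zero s h =
  trans (sym (+-assoc (s 0 ⊔ s 1) (s 0 ⊓ s 1) _)) (trans (cong (_+ total L (λ q → s (suc (suc q)))) (⊔+⊓≡+ (s 0) (s 1))) (+-assoc (s 0) (s 1) _))
total-sort (suc L) (suc k) s (s≤s h) = cong (s 0 +_) (trans (total-cong L (λ q _ → act-shift s k (suc q))) (total-sort L k (λ q → s (suc q)) h))

sort-fixes : ∀ s → s 1 ≤ s 0 → act s 1 ≗ s
sort-fixes s s1≤s0 p = trans (set₂-cong 0 (m≥n⇒m⊔n≡m s1≤s0) (m≥n⇒m⊓n≡n s1≤s0) (λ _ → refl) p) (set₂-self 0 s p)

sort-lowers : ∀ L s → s 0 < s 1 → potential (suc (suc L)) (act s 1) < potential (suc (suc L)) s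
sort-lowers L s a<b =
  +-mono-≤-< (≤-reflexive (trans (sym (+-assoc (a ⊔ b) (a ⊓ b) _)) (trans (cong (_+ total L R) (⊔+⊓≡+ a b)) (+-assoc a b _))))
             (+-monoˡ-< (potential L R) (+-monoˡ-< (total L R) (subst (_< b) (sym (m≤n⇒m⊓n≡m (<⇒≤ a<b))) a<b)))
  where
  a = s 0
  b = s 1
  R = λ q → s (suc (suc q))

act-lowers-or-fixes : ∀ L x s → x < L → potential L (act s x) < potential L s ⊎ Agree L (act s x) s
act-lowers-or-fixes (suc L) zero s _ with s 0 ≟ 0
... | yes s0≡0 = inj₂ cleared
  where
  cleared : Agree (suc L) (clear₀ s) s
  cleared zero    _ = sym s0≡0
  cleared (suc q) _ = refl
... | no s0≢0 = inj₁ (+-monoˡ-< (potential L (s ∘ suc)) (+-monoˡ-< (total L (s ∘ suc)) (n≢0⇒n>0 s0≢0)))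
act-lowers-or-fixes (suc (suc L)) (suc zero) s _ with s 0 <? s 1
... | yes s0<s1 = inj₁ (sort-lowers L s s0<s1)
... | no s0≮s1  = inj₂ (λ p _ → sort-fixes s (≮⇒≥ s0≮s1) p)
act-lowers-or-fixes (suc L) (suc (suc k)) s (s≤s k+2<L) with act-lowers-or-fixes L (suc k) (s ∘ suc) k+2<L
... | inj₁ lower = inj₁ (subst (_< potential (suc L) s) (sym shifted)
                             (+-mono-≤-< (≤-reflexive (cong (s 0 +_) (total-sort L k (s ∘ suc) k+2<L))) lower))
  where
  shifted : potential (suc L) (act s (suc (suc k))) ≡ (s 0 + total L (act (s ∘ suc) (suc k))) + potential L (act (s ∘ suc) (suc k))
  shifted = cong₂ _+_ (cong (s 0 +_) (total-cong L (λ q _ → act-shift s k (suc q)))) (potential-cong L (λ q _ → act-shift s k (suc q)))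
... | inj₂ fixed = inj₂ fixed′
  where
  fixed′ : Agree (suc L) (act s (suc (suc k))) s
  fixed′ zero    _         = refl
  fixed′ (suc q) (s≤s q<L) = trans (act-shift s k (suc q)) (fixed q q<L)

Fixes : ℕ → ℕWord → Config → Set
Fixes L w s = All (λ x → Agree L (act s x) s) w

potential-run-≤ : ∀ L s w → All (_< L) w → potential L (run s w) ≤ potential L s
potential-run-≤ L s [] [] = ≤-refl
potential-run-≤ L s (x ∷ w) (hx ∷ a) with act-lowers-or-fixes L x s hx
... | inj₁ lt = ≤-trans (potential-run-≤ L (act s x) w a) (<⇒≤ lt)
... | inj₂ e = ≤-trans (potential-run-≤ L (act s x) w a) (≤-reflexive (potential-cong L e))

potential-run-≡⇒fixes : ∀ L s w → All (_< L) w → potential L (run s w) ≡ potential L s → Fixes L w s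
potential-run-≡⇒fixes L s [] [] eq = []
potential-run-≡⇒fixes L s (x ∷ w) (hx ∷ a) eq with act-lowers-or-fixes L x s hx
... | inj₁ lt = ⊥-elim (<-irrefl eq (≤-<-trans (potential-run-≤ L (act s x) w a) lt))
... | inj₂ e = e ∷ potential-run-≡⇒fixes L s w a (trans (sym (potential-cong L (run-cong< L w a e))) eq)

run-fixed : ∀ L s w → All (_< L) w → Fixes L w s → Agree L (run s w) s
run-fixed L s []      []           []         p p<L = refl
run-fixed L s (x ∷ w) (x<L ∷ w<L) (fx ∷ fw) p p<L = trans (run-cong< L w w<L fx p p<L) (run-fixed L s w w<L fw p p<L)

Fixes-resp : ∀ L w → All (_< L) w → ∀ {s t} → Agree L s t → Fixes L w s → Fixes L w t
Fixes-resp L []      []           s≈t []        = []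
Fixes-resp L (x ∷ w) (x<L ∷ w<L) s≈t (fx ∷ fw) =
  (λ p p<L → trans (sym (act-cong< L x x<L s≈t p p<L)) (trans (fx p p<L) (s≈t p p<L)))
  ∷ Fixes-resp L w w<L s≈t fw

power : ∀ {A : Set} → List A → ℕ → List A
power w zero    = []
power w (suc k) = w ++ power w k

power-All : ∀ {A : Set} {P : A → Set} {w} → All P w → ∀ k → All P (power w k)
power-All Pw zero    = []
power-All Pw (suc k) = ++⁺ Pw (power-All Pw k)

power-fixed : ∀ L s w → All (_< L) w → Fixes L w s → ∀ k → Agree L (run s (power w k)) s
power-fixed L s w w<L fw zero    p p<L = refl
power-fixed L s w w<L fw (suc k) p p<L =
  trans (run-++-at s w (power w k) p)
  (trans (run-cong< L (power w k) (power-All w<L k) (run-fixed L s w w<L fw) p p<L)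
         (power-fixed L s w w<L fw k p p<L))

-- Every round of w either lowers the potential or fixes the configuration, so
-- after more than `potential L s` rounds the letters of w are fixed points.
power-stabilizes : ∀ L w → All (_< L) w → ∀ k s → potential L s < k → Fixes L w (run s (power w k))
power-stabilizes L w w<L (suc k) s pot<k+1 with potential L (run s w) ≟ potential L s
... | yes same = Fixes-resp L w w<L (λ p p<L → sym (power-fixed L s w w<L fw (suc k) p p<L)) fw
  where
  fw : Fixes L w s
  fw = potential-run-≡⇒fixes L s w w<L same
... | no lower =
  subst (Fixes L w) (sym (run-++ s w (power w k)))
        (power-stabilizes L w w<L k (run s w) (<-≤-trans (≤∧≢⇒< (potential-run-≤ L s w w<L) lower) (≤-pred pot<k+1)))

power-⟪⟫ : ∀ {n} (w : Word n) k → ⟪ power w k ⟫ ≡ power ⟪ w ⟫ k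
power-⟪⟫ w zero    = refl
power-⟪⟫ w (suc k) = trans (map-++ toℕ w (power w k)) (cong (⟪ w ⟫ ++_) (power-⟪⟫ w k))

power-comm : ∀ {A : Set} (v : List A) k → v ++ power v k ≡ power v k ++ v
power-comm v zero    = ++-identityʳ v
power-comm v (suc k) = trans (cong (v ++_) (power-comm v k)) (sym (++-assoc v (power v k) v))

reverse-power : ∀ {A : Set} (v : List A) k → reverse (power v k) ≡ power (reverse v) k
reverse-power v zero    = refl
reverse-power v (suc k) =
  trans (reverse-++ v (power v k)) (trans (cong (_++ reverse v) (reverse-power v k)) (sym (power-comm (reverse v) k)))

power-⊆ : ∀ {A : Set} (v : List A) k → power v k ⊆ v
power-⊆ v (suc k) x∈ with ∈-++⁻ v x∈
... | inj₁ x∈v = x∈v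
... | inj₂ x∈p = power-⊆ v k x∈p

⊆-power : ∀ {A : Set} (v : List A) k → v ⊆ power v (suc k)
⊆-power v k = xs⊆xs++ys v (power v k)

module _ {n : ℕ} where

  ⟪⟫-letters : (w : Word n) → All (_< n) ⟪ w ⟫
  ⟪⟫-letters []      = []
  ⟪⟫-letters (f ∷ w) = toℕ<n f ∷ ⟪⟫-letters w

  run-faithful : (u v : Word n) → Agree n (run initial ⟪ u ⟫) (run initial ⟪ v ⟫) → u ∼ v
  run-faithful u v agree = Restrict.≈⇒∼ n (faithful n ⟪ u ⟫ ⟪ v ⟫ (⟪⟫-letters u) (⟪⟫-letters v) agree)

  ∼⇒run≗ : ∀ {u v : Word n} → u ∼ v → ∀ p → run initial ⟪ u ⟫ p ≡ run initial ⟪ v ⟫ p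
  ∼⇒run≗ u∼v = ≈⇒run≗ (∼⇒≈ u∼v) initial

  run-⟪++⟫ : (u v : Word n) → ∀ p → run initial ⟪ u ++ v ⟫ p ≡ run (run initial ⟪ u ⟫) ⟪ v ⟫ p
  run-⟪++⟫ u v p = trans (cong (λ w → run initial w p) (map-++ toℕ u v)) (run-++-at initial ⟪ u ⟫ ⟪ v ⟫ p)

  absorbʳ : (w : Word n) (f : Fin n) → Agree n (act (run initial ⟪ w ⟫) (toℕ f)) (run initial ⟪ w ⟫) →
            (w ++ f ∷ []) ∼ w
  absorbʳ w f fixed = run-faithful (w ++ f ∷ []) w (λ p p<n → trans (run-⟪++⟫ w (f ∷ []) p) (fixed p p<n))

  reverse-⟶ : ∀ {l r : Word n} → l ⟶ r → reverse l ∼ reverse r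
  reverse-⟶ (idem a)          = ⟶⇒∼ (idem a)
  reverse-⟶ (braid a b h e)   = ⟶⇒∼ (braid a b h e)
  reverse-⟶ (left a b ea eb)  = ⟶⇒∼ (right a b ea eb)
  reverse-⟶ (right a b ea eb) = ⟶⇒∼ (left a b ea eb)
  reverse-⟶ (comm a b h)      = ∼-sym (⟶⇒∼ (comm a b h))

  reverse-++₃ : ∀ (x l y : Word n) → reverse (x ++ l ++ y) ≡ reverse y ++ reverse l ++ reverse x
  reverse-++₃ x l y =
    trans (reverse-++ x (l ++ y)) (trans (cong (_++ reverse x) (reverse-++ l y)) (++-assoc (reverse y) (reverse l) (reverse x)))

  reverse-∼ : ∀ {u v : Word n} → u ∼ v → reverse u ∼ reverse v
  reverse-∼ ∼-refl        = ∼-refl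
  reverse-∼ (∼-sym p)     = ∼-sym (reverse-∼ p)
  reverse-∼ (∼-trans p q) = ∼-trans (reverse-∼ p) (reverse-∼ q)
  reverse-∼ (∼-step x y {l} {r} R) =
    subst₂ _∼_ (sym (reverse-++₃ x l y)) (sym (reverse-++₃ x r y)) (∼-cong (reverse y) (reverse x) (reverse-⟶ R))

  absorbˡ : (w : Word n) (f : Fin n) → (reverse w ++ f ∷ []) ∼ reverse w → (f ∷ w) ∼ w
  absorbˡ w f absorbed = subst₂ _∼_ reversed (reverse-involutive w) (reverse-∼ absorbed)
    where
    reversed : reverse (reverse w ++ f ∷ []) ≡ f ∷ w
    reversed = trans (reverse-++ (reverse w) (f ∷ [])) (cong (f ∷_) (reverse-involutive w))

  absorbs-allʳ : ∀ {P : Fin n → Set} (z : Word n) → (∀ f → P f → (z ++ f ∷ []) ∼ z) → ∀ x → All P x → (z ++ x) ∼ z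
  absorbs-allʳ z absorbs []      []          = ≡⇒∼ (++-identityʳ z)
  absorbs-allʳ z absorbs (f ∷ x) (Pf ∷ Px) =
    ∼-trans (≡⇒∼ (sym (++-assoc z (f ∷ []) x)))
            (∼-trans (∼-congʳ x (absorbs f Pf)) (absorbs-allʳ z absorbs x Px))

  absorbs-allˡ : ∀ {P : Fin n → Set} (z : Word n) → (∀ f → P f → (f ∷ z) ∼ z) → ∀ x → All P x → (x ++ z) ∼ z
  absorbs-allˡ z absorbs []      []        = ∼-refl
  absorbs-allˡ z absorbs (f ∷ x) (Pf ∷ Px) = ∼-trans (∼-congˡ (f ∷ []) (absorbs-allˡ z absorbs x Px)) (absorbs f Pf)

  ⊆-from : ∀ {u v : Word n} → All (_∈ v) u → u ⊆ v
  ⊆-from = All.lookup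

  ⟶⇒⊆ : ∀ {l r : Word n} → l ⟶ r → l ⊆ r × r ⊆ l
  ⟶⇒⊆ (idem a)          = ⊆-from (here refl ∷ here refl ∷ []) , ⊆-from (here refl ∷ [])
  ⟶⇒⊆ (braid a b h e)   = ⊆-from (there (here refl) ∷ here refl ∷ there (here refl) ∷ [])
                        , ⊆-from (there (here refl) ∷ here refl ∷ there (here refl) ∷ [])
  ⟶⇒⊆ (left a b ea eb)  = ⊆-from (there (here refl) ∷ here refl ∷ there (here refl) ∷ here refl ∷ [])
                        , ⊆-from (there (here refl) ∷ here refl ∷ there (here refl) ∷ [])
  ⟶⇒⊆ (right a b ea eb) = ⊆-from (here refl ∷ there (here refl) ∷ here refl ∷ there (here refl) ∷ [])
                        , ⊆-from (here refl ∷ there (here refl) ∷ here refl ∷ [])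
  ⟶⇒⊆ (comm a b h)      = ⊆-from (there (here refl) ∷ here refl ∷ [])
                        , ⊆-from (there (here refl) ∷ here refl ∷ [])

  ∼⇒⊆ : ∀ {u v : Word n} → u ∼ v → u ⊆ v × v ⊆ u
  ∼⇒⊆ ∼-refl        = ⊆-refl , ⊆-refl
  ∼⇒⊆ (∼-sym p)     = swap (∼⇒⊆ p)
  ∼⇒⊆ (∼-trans p q) = ⊆-trans (proj₁ (∼⇒⊆ p)) (proj₁ (∼⇒⊆ q)) , ⊆-trans (proj₂ (∼⇒⊆ q)) (proj₂ (∼⇒⊆ p))
  ∼⇒⊆ (∼-step x y R) = ++⁺ʳ x (++⁺ˡ y (proj₁ (⟶⇒⊆ R))) , ++⁺ʳ x (++⁺ˡ y (proj₂ (⟶⇒⊆ R)))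

  exponent : ℕ
  exponent = suc (potential n initial)

  stable : Word n → Word n
  stable v = power v exponent

  stable-absorbʳ : ∀ v f → f ∈ v → (stable v ++ f ∷ []) ∼ stable v
  stable-absorbʳ v f f∈v = absorbʳ (stable v) f (subst (λ w → Agree n (act (run initial w) (toℕ f)) (run initial w))
    (sym (power-⟪⟫ v exponent))
    (All.lookup (power-stabilizes n ⟪ v ⟫ (⟪⟫-letters v) exponent initial (n<1+n _)) (∈-map⁺ toℕ f∈v)))

  stable-absorbˡ : ∀ v f → f ∈ v → (f ∷ stable v) ∼ stable v
  stable-absorbˡ v f f∈v = absorbˡ (stable v) f
    (subst (λ w → (w ++ f ∷ []) ∼ w) (sym (reverse-power v exponent)) (stable-absorbʳ (reverse v) f (AnyP.reverse⁺ f∈v)))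

  -- An idempotent fixes its own configuration s, so no letter of it can lower the
  -- potential of s: every letter fixes s.
  idempotent-absorbs : (e : Word n) → IsIdempotent e → ∀ f → f ∈ e → (e ++ f ∷ []) ∼ e
  idempotent-absorbs e e·e∼e f f∈e = absorbʳ e f (All.lookup letters-fix (∈-map⁺ toℕ f∈e))
    where
    s = run initial ⟪ e ⟫
    e-fixes : Agree n (run s ⟪ e ⟫) s
    e-fixes p _ = trans (sym (run-⟪++⟫ e e p)) (∼⇒run≗ e·e∼e p)
    letters-fix : Fixes n ⟪ e ⟫ s
    letters-fix = potential-run-≡⇒fixes n s ⟪ e ⟫ (⟪⟫-letters e) (potential-cong n e-fixes)

  elements : Subset n → Word n
  elements S = filter (_∈? S) (allFin n)

  ∈-elements⁺ : ∀ {S f} → f ∈S S → f ∈ elements S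
  ∈-elements⁺ {S} {f} f∈S = ∈-filter⁺ (_∈? S) (∈-allFin f) f∈S

  ∈-elements⁻ : ∀ {S f} → f ∈ elements S → f ∈S S
  ∈-elements⁻ {S} f∈ = proj₂ (∈-filter⁻ (_∈? S) {xs = allFin n} f∈)

  content : Word n → Subset n
  content = foldr (λ f S → ⁅ f ⁆ ∪ S) ∅

  content-⁺ : (w : Word n) → All (_∈S content w) w
  content-⁺ []      = []
  content-⁺ (f ∷ w) = x∈p∪q⁺ {p = ⁅ f ⁆} (inj₁ (x∈⁅x⁆ f)) ∷ All.map (λ g∈ → x∈p∪q⁺ {p = ⁅ f ⁆} (inj₂ g∈)) (content-⁺ w)

  content-⁻ : ∀ (w : Word n) {f} → f ∈S content w → f ∈ w
  content-⁻ []      f∈ = ⊥-elim (∉⊥ f∈)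
  content-⁻ (g ∷ w) f∈ with x∈p∪q⁻ ⁅ g ⁆ (content w) f∈
  ... | inj₁ f∈⁅g⁆ = here (x∈⁅y⁆⇒x≡y g f∈⁅g⁆)
  ... | inj₂ f∈w  = there (content-⁻ w f∈w)

  π : Subset n → Word n
  π S = stable (elements S)

  π-letters : ∀ S → InSubmonoid S (π S)
  π-letters S = power-All (All.tabulate ∈-elements⁻) exponent

  π-zero : ∀ S → IsZeroOf S (π S)
  π-zero S = π-letters S , λ x x∈S →
    absorbs-allʳ (π S) (λ f f∈S → stable-absorbʳ (elements S) f (∈-elements⁺ f∈S)) x x∈S ,
    absorbs-allˡ (π S) (λ f f∈S → stable-absorbˡ (elements S) f (∈-elements⁺ f∈S)) x x∈S

  π-idempotent : ∀ S → IsIdempotent (π S)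
  π-idempotent S = proj₁ (proj₂ (π-zero S) (π S) (π-letters S))

  π-⊆ : ∀ {S T} → π S ∼ π T → S ⊆S T
  π-⊆ {S} {T} πS∼πT f∈S =
    ∈-elements⁻ (power-⊆ (elements T) exponent (proj₁ (∼⇒⊆ πS∼πT) (⊆-power (elements S) (potential n initial) (∈-elements⁺ f∈S))))

  π-injective : ∀ S T → π S ∼ π T → S ≡ T
  π-injective S T πS∼πT = ⊆-antisym (π-⊆ πS∼πT) (π-⊆ (∼-sym πS∼πT))

  idempotent∼π : ∀ e → IsIdempotent e → e ∼ π (content e)
  idempotent∼π e e·e∼e =
    ∼-trans (∼-sym (absorbs-allʳ e (λ f f∈S → idempotent-absorbs e e·e∼e f (content-⁻ e f∈S)) (π S) (π-letters S)))
            (proj₂ (proj₂ (π-zero S) e (content-⁺ e)))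
    where
    S = content e

proposition5p7 : (n : ℕ) →
    Σ (Subset n → Word n) λ π →
    ((S : Subset n) → IsZeroOf S (π S))
    × ((S : Subset n) → IsIdempotent (π S))
    × ((S T : Subset n) → π S ∼ π T → S ≡ T)
    × ((e : Word n) → IsIdempotent e → ∃ λ S → e ∼ π S)
proposition5p7 n = π , π-zero , π-idempotent , π-injective , λ e idem → content e , idempotent∼π e idem
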